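{- Let $k\geq2$ and let $\tau=\rho1\in S_k(312)$, i.e. $\tau$ ends with the entry $1$ and $\rho$ is the sequence of its first $k-1$ entries. Then $$F_\tau(x,q)=\frac{1}{1-xq-x(F_{\rho}(x,q)-1)},$$ and moreover $$\frac{\partial}{\partial q} F_{\tau}(x,q)\Big|_{q=1}=xF^2_{\tau}(x,1)\left(1+\frac{\partial}{\partial q}F_{\rho}(x,q)\Big|_{q=1}\right).$$
   Context: For $\tau\in S_k(312)$, $F_\tau(x,q)=\sum_{n\geq0}\sum_{\sigma\in S_n(312,\tau)}x^nq^{L_n(\sigma)}$, where $S_n(312,\tau)$ is the set of permutations of $[n]$ avoiding the patterns $312$ and $\tau$ (the empty permutation counted for $n=0$), and $L_n(\sigma)$ is the length of a longest increasing subsequence ($0$ for the empty permutation). For a sequence $w$ of distinct integers, $F_w:=F_v$ where $v$ is the reduced form of $w$ (the permutation with the same relative order as $w$). -}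

module Defs where

open import Data.Bool using (Bool; true; false; not; _∧_)
open import Data.Nat as ℕ using (ℕ; zero; suc; _<ᵇ_; _≡ᵇ_; _⊔_)
open import Data.Integer as ℤ using (ℤ; +_)
open import Data.List using (List; []; _∷_; _++_; map; concatMap; filterᵇ; length; foldr)
open import Data.Bool.ListAction using (any)
open import Data.List.Properties using (≡-dec)
open import Relation.Nullary using (does)

insertAll : ℕ → List ℕ → List (List ℕ)
insertAll x []       = (x ∷ []) ∷ []
insertAll x (y ∷ ys) = (x ∷ y ∷ ys) ∷ map (y ∷_) (insertAll x ys)

-- S n : all permutations of [n] = {1,…,n}, as one-line words
-- (each exactly once; built by inserting n into every permutation of [n-1])
S : ℕ → List (List ℕ)
S zero    = [] ∷ []
S (suc n) = concatMap (insertAll (suc n)) (S n)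

-- all subsequences (as position-subsets, with multiplicity)
subseqs : List ℕ → List (List ℕ)
subseqs []       = [] ∷ []
subseqs (x ∷ xs) = map (x ∷_) (subseqs xs) ++ subseqs xs

countᵇ : (ℕ → Bool) → List ℕ → ℕ
countᵇ p []       = 0
countᵇ p (x ∷ xs) = if′ p x then suc (countᵇ p xs) else countᵇ p xs
  where
  if′_then_else_ : Bool → ℕ → ℕ → ℕ
  if′ true  then a else b = a
  if′ false then a else b = b

red : List ℕ → List ℕ
red w = map (λ a → suc (countᵇ (_<ᵇ a) w)) w

_==ᴸ_ : List ℕ → List ℕ → Bool
u ==ᴸ v = does (≡-dec ℕ._≟_ u v)

contains : List ℕ → List ℕ → Bool
contains w p = any (λ s → red s ==ᴸ p) (subseqs w)

avoids : List ℕ → List ℕ → Bool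
avoids w p = not (contains w p)

p312 : List ℕ
p312 = 3 ∷ 1 ∷ 2 ∷ []

increasing : List ℕ → Bool
increasing []           = true
increasing (x ∷ [])     = true
increasing (x ∷ y ∷ ys) = (x <ᵇ y) ∧ increasing (y ∷ ys)

lis : List ℕ → ℕ
lis w = foldr _⊔_ 0 (map length (filterᵇ increasing (subseqs w)))

-- bivariate formal power series in x, q: coefficient of x^n q^m
FPS₂ : Set
FPS₂ = ℕ → ℕ → ℤ

FPS₁ : Set
FPS₁ = ℕ → ℤ

sumTo : ℕ → (ℕ → ℤ) → ℤ
sumTo zero    f = f 0
sumTo (suc n) f = sumTo n f ℤ.+ f (suc n)

δ : ℕ → ℤ
δ zero    = + 1
δ (suc _) = + 0

one₂ : FPS₂
one₂ n m = δ n ℤ.* δ m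

X₂ : FPS₂             -- the series x
X₂ n m = δ (n ℕ.∸ 1) ℤ.* (if1 n) ℤ.* δ m
  where
  if1 : ℕ → ℤ
  if1 zero = + 0
  if1 (suc _) = + 1

XQ₂ : FPS₂            -- the series x q
XQ₂ n m = X₂ n 0 ℤ.* X₂ m 0

_+₂_ : FPS₂ → FPS₂ → FPS₂
(f +₂ g) n m = f n m ℤ.+ g n m

_-₂_ : FPS₂ → FPS₂ → FPS₂
(f -₂ g) n m = f n m ℤ.- g n m

_*₂_ : FPS₂ → FPS₂ → FPS₂
(f *₂ g) n m = sumTo n (λ i → sumTo m (λ j → f i j ℤ.* g (n ℕ.∸ i) (m ℕ.∸ j)))

infixl 6 _+₂_ _-₂_
infixl 7 _*₂_

one₁ : FPS₁
one₁ = δ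

X₁ : FPS₁
X₁ n = X₂ n 0

_+₁_ : FPS₁ → FPS₁ → FPS₁
(f +₁ g) n = f n ℤ.+ g n

_*₁_ : FPS₁ → FPS₁ → FPS₁
(f *₁ g) n = sumTo n (λ i → f i ℤ.* g (n ℕ.∸ i))

infixl 6 _+₁_
infixl 7 _*₁_

-- For a bivariate series whose x^n-coefficient is a polynomial in q of
-- degree ≤ n (true for every F_τ, since L_n(σ) ≤ n):
-- evaluation at q = 1, and ∂/∂q at q = 1.
atQ1 : FPS₂ → FPS₁
atQ1 f n = sumTo n (λ m → f n m)

dQatQ1 : FPS₂ → FPS₁
dQatQ1 f n = sumTo n (λ m → + m ℤ.* f n m)

coef : List ℕ → ℕ → ℕ → ℕ
coef τ n m = length (filterᵇ (λ σ → avoids σ p312 ∧ avoids σ τ ∧ (lis σ ≡ᵇ m)) (S n))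

F : List ℕ → FPS₂
F w n m = + coef (red w) n m

-- A 312-avoiding permutation σ of [n+1] splits at its entry 1: everything left of 1 lies below
-- everything right of it, so σ = (α ⊖1) ⊕ β with α, β 312-avoiding permutations of [a], [b],
-- a + b = n. Both 312 (it begins with its maximum) and τ = ρ1 = red ρ ⊖1 (it ends with its minimum)
-- are sum-indecomposable, so each of their occurrences in σ lies in one block: σ avoids 312 and τ
-- iff α avoids 312 and ρ and β avoids 312 and τ. Moreover lis σ = max(lis α, 1) + lis β. Summing
-- over the decomposition gives F_τ = 1 + x F_τ (q + F_ρ − 1), i.e. F_τ (1 − xq − x(F_ρ − 1)) = 1.
-- Evaluating this identity and its q-derivative at q = 1 (legitimate since every x^n-coefficient
-- is a polynomial in q of degree ≤ n) and solving for ∂F_τ/∂q gives the second formula.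

module Submission where

open import Defs
open import Data.Nat using (ℕ; _≤_)
open import Data.List using (List; _∷_; []; _++_)
open import Data.List.Membership.Propositional using (_∈_)
open import Data.Bool using (T)
open import Data.Product using (_×_)
open import Relation.Binary.PropositionalEquality using (_≡_)

open import Data.Bool using (Bool; true; false; not; _∧_; T?; if_then_else_)
open import Data.Bool.Properties using (∧-assoc; T-∧; T-≡)
open import Data.Empty using (⊥-elim)
open import Data.Integer as ℤ using (ℤ)
import Data.Integer.Properties as ℤₚ
open import Data.Integer.Tactic.RingSolver using (solve-∀)
open import Data.List using ([_]; map; concat; concatMap; filterᵇ; filter; length; foldr; applyUpTo; upTo; initLast; _∷ʳ′_)
import Data.List.Properties as Listₚ
open import Data.List.Membership.Propositional using (_∉_; find; lose)
open import Data.List.Membership.Propositional.Properties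
  using (∈-++⁺ʳ; ∈-++⁺ˡ; ∈-++⁻; ∈-applyUpTo⁺; ∈-applyUpTo⁻; ∈-concatMap⁺; ∈-concatMap⁻; ∈-concat⁺′; ∈-concat⁻′;
         ∈-filter⁺; ∈-filter⁻; ∈-map⁺; ∈-map⁻; ∈-upTo⁺; ∈-upTo⁻; ∈-∃++)
open import Data.List.Membership.Propositional.Properties.WithK using (unique∧set⇒bag)
open import Data.List.Relation.Binary.BagAndSetEquality using (∼bag⇒↭)
open import Data.List.Relation.Binary.Permutation.Propositional as ↭
  using (_↭_; prep; swap; ↭-refl; ↭-sym; ↭-trans; ↭-reflexive; ↭⇒↭ₛ; module PermutationReasoning)
open import Data.List.Relation.Binary.Permutation.Propositional.Properties
  using (shift; drop-mid; ↭-empty-inv; ↭-length; ↭-map-inv; ∈-resp-↭; ∷↭∷ʳ; ++⁺; map⁺)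
import Data.List.Relation.Binary.Permutation.Setoid.Properties as PermutationSetoidₚ
open import Data.List.Relation.Binary.Sublist.Propositional using (_⊆_; []; _∷_; _∷ʳ_; ⊆-refl; ⊆-trans; minimum; from∈)
import Data.List.Relation.Binary.Sublist.Propositional.Properties as Sublistₚ
open import Data.List.Relation.Unary.All as All using (All; []; _∷_)
import Data.List.Relation.Unary.All.Properties as Allₚ
open import Data.List.Relation.Unary.AllPairs using ([]; _∷_)
open import Data.List.Relation.Unary.Any using (here; there)
import Data.List.Relation.Unary.Any.Properties as Anyₚ
open import Data.List.Relation.Unary.Unique.Propositional using (Unique)
import Data.List.Relation.Unary.Unique.Propositional.Properties as Uniqueₚ
open import Data.Nat as ℕ using (zero; suc; _∸_; _<_; _<ᵇ_; _≡ᵇ_; _⊔_; z≤n; s≤s)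
open import Data.Nat.ListAction using (sum)
open import Data.Nat.ListAction.Properties using (sum-++)
import Data.Nat.Properties as ℕₚ
open import Data.List.Membership.DecPropositional ℕₚ._≟_ using (_∈?_)
open import Data.Product using (∃; ∃₂; _,_; proj₁; proj₂; map₁)
open import Data.Sum as Sum using (_⊎_; inj₁; inj₂)
open import Function using (_∘_; _∘′_)
open import Function.Bundles using (Equivalence; mk⇔)
open import Relation.Binary.Definitions using (tri<; tri≈; tri>)
open import Relation.Binary.PropositionalEquality hiding ([_])
open import Relation.Nullary using (¬_; ¬?; yes; no)

module Combinatorics where

  open import Data.Nat using (_+_; _*_)
  open import Algebra.Properties.CommutativeSemigroup ℕₚ.+-commutativeSemigroup using () renaming (interchange to ℕ-interchange)

  count : {A : Set} → (A → Bool) → List A → ℕ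
  count p []       = 0
  count p (x ∷ xs) = if p x then suc (count p xs) else count p xs

  module _ {A : Set} (p : A → Bool) where

    length-filterᵇ : ∀ xs → length (filterᵇ p xs) ≡ count p xs
    length-filterᵇ []       = refl
    length-filterᵇ (x ∷ xs) with p x
    ... | true  = cong suc (length-filterᵇ xs)
    ... | false = length-filterᵇ xs

    count-++ : ∀ xs ys → count p (xs ++ ys) ≡ count p xs + count p ys
    count-++ []       ys = refl
    count-++ (x ∷ xs) ys with p x
    ... | true  = cong suc (count-++ xs ys)
    ... | false = count-++ xs ys

    count-concat : ∀ xss → count p (concat xss) ≡ sum (map (count p) xss)
    count-concat []         = refl
    count-concat (xs ∷ xss) = trans (count-++ xs (concat xss)) (cong (count p xs +_) (count-concat xss))

    count-concatMap : ∀ {B : Set} (f : B → List A) xs → count p (concatMap f xs) ≡ sum (map (count p ∘ f) xs)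
    count-concatMap f xs = trans (count-concat (map f xs)) (cong sum (sym (Listₚ.map-∘ xs)))

    count-↭ : ∀ {xs ys} → xs ↭ ys → count p xs ≡ count p ys
    count-↭ ↭.refl = refl
    count-↭ (prep x xs↭ys) with p x
    ... | true  = cong suc (count-↭ xs↭ys)
    ... | false = count-↭ xs↭ys
    count-↭ (swap x y xs↭ys) with p x | p y
    ... | true  | true  = cong (suc ∘′ suc) (count-↭ xs↭ys)
    ... | true  | false = cong suc (count-↭ xs↭ys)
    ... | false | true  = cong suc (count-↭ xs↭ys)
    ... | false | false = count-↭ xs↭ys
    count-↭ (↭.trans xs↭ys ys↭zs) = trans (count-↭ xs↭ys) (count-↭ ys↭zs)

    count-filterᵇ : ∀ (q : A → Bool) xs → count p (filterᵇ q xs) ≡ count (λ x → q x ∧ p x) xs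
    count-filterᵇ q []       = refl
    count-filterᵇ q (x ∷ xs) with q x
    ... | false = count-filterᵇ q xs
    ... | true with p x
    ...   | true  = cong suc (count-filterᵇ q xs)
    ...   | false = count-filterᵇ q xs

    count≤length : ∀ xs → count p xs ≤ length xs
    count≤length []       = z≤n
    count≤length (x ∷ xs) with p x
    ... | true  = s≤s (count≤length xs)
    ... | false = ℕₚ.m≤n⇒m≤1+n (count≤length xs)

    count-none : ∀ {xs} → All (λ x → p x ≡ false) xs → count p xs ≡ 0
    count-none []             = refl
    count-none (px≡f ∷ pxs) rewrite px≡f = count-none pxs

    count-all : ∀ {xs} → All (λ x → p x ≡ true) xs → count p xs ≡ length xs
    count-all []             = refl
    count-all (px≡t ∷ pxs) rewrite px≡t = cong suc (count-all pxs)

    count≡0⇒none : ∀ xs → count p xs ≡ 0 → All (λ x → p x ≡ false) xs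
    count≡0⇒none []       _ = []
    count≡0⇒none (x ∷ xs) c≡0 with p x in px≡
    ... | false = px≡ ∷ count≡0⇒none xs c≡0

  count-map : {A B : Set} (p : B → Bool) (f : A → B) (xs : List A) → count p (map f xs) ≡ count (p ∘ f) xs
  count-map p f []       = refl
  count-map p f (x ∷ xs) with p (f x)
  ... | true  = cong suc (count-map p f xs)
  ... | false = count-map p f xs

  count-cong : {A : Set} {p q : A → Bool} (xs : List A) →
               (∀ {x} → x ∈ xs → p x ≡ q x) → count p xs ≡ count q xs
  count-cong []       p≗q = refl
  count-cong {q = q} (x ∷ xs) p≗q rewrite p≗q (here refl) with q x
  ... | true  = cong suc (count-cong xs (p≗q ∘ there))
  ... | false = count-cong xs (p≗q ∘ there)

  ⊆⇒∈-subseqs : ∀ {s w} → s ⊆ w → s ∈ subseqs w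
  ⊆⇒∈-subseqs []                    = here refl
  ⊆⇒∈-subseqs (_∷ʳ_ {ys = w} x s⊆w) = ∈-++⁺ʳ (map (x ∷_) (subseqs w)) (⊆⇒∈-subseqs s⊆w)
  ⊆⇒∈-subseqs (refl ∷ s⊆w)          = ∈-++⁺ˡ (∈-map⁺ _ (⊆⇒∈-subseqs s⊆w))

  ∈-subseqs⇒⊆ : ∀ {s} w → s ∈ subseqs w → s ⊆ w
  ∈-subseqs⇒⊆ []      (here refl) = []
  ∈-subseqs⇒⊆ (x ∷ w) s∈ with ∈-++⁻ (map (x ∷_) (subseqs w)) s∈
  ... | inj₂ s∈′ = x ∷ʳ ∈-subseqs⇒⊆ w s∈′
  ... | inj₁ s∈′ with ∈-map⁻ (x ∷_) s∈′
  ...   | _ , s′∈ , refl = refl ∷ ∈-subseqs⇒⊆ w s′∈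

  ⊆-++⁻ : ∀ {A : Set} {s : List A} u {v} → s ⊆ u ++ v →
          ∃₂ λ s₁ s₂ → s ≡ s₁ ++ s₂ × s₁ ⊆ u × s₂ ⊆ v
  ⊆-++⁻ []      s⊆v = [] , _ , refl , [] , s⊆v
  ⊆-++⁻ (x ∷ u) (.x ∷ʳ s⊆) with ⊆-++⁻ u s⊆
  ... | s₁ , s₂ , refl , s₁⊆u , s₂⊆v = s₁ , s₂ , refl , x ∷ʳ s₁⊆u , s₂⊆v
  ⊆-++⁻ (x ∷ u) (refl ∷ s⊆) with ⊆-++⁻ u s⊆
  ... | s₁ , s₂ , refl , s₁⊆u , s₂⊆v = x ∷ s₁ , s₂ , refl , refl ∷ s₁⊆u , s₂⊆v

  ⊆-map⁻ : ∀ {A B : Set} (f : A → B) {s} w → s ⊆ map f w → ∃ λ s′ → s ≡ map f s′ × s′ ⊆ w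
  ⊆-map⁻ f []      []          = [] , refl , []
  ⊆-map⁻ f (x ∷ w) (_ ∷ʳ s⊆) with ⊆-map⁻ f w s⊆
  ... | s′ , refl , s′⊆w = s′ , refl , x ∷ʳ s′⊆w
  ⊆-map⁻ f (x ∷ w) (refl ∷ s⊆) with ⊆-map⁻ f w s⊆
  ... | s′ , refl , s′⊆w = x ∷ s′ , refl , refl ∷ s′⊆w

  ⊆-[_]⁻ : ∀ {A : Set} {s} (x : A) → s ⊆ [ x ] → s ≡ [] ⊎ s ≡ [ x ]
  ⊆-[ x ]⁻ (.x ∷ʳ []) = inj₁ refl
  ⊆-[ x ]⁻ (refl ∷ []) = inj₂ refl

  ∷ʳ-⊆-∷ʳ⁻ : ∀ {A : Set} {s w : List A} {y x} → s ++ [ y ] ⊆ w ++ [ x ] → s ⊆ w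
  ∷ʳ-⊆-∷ʳ⁻ {s = s} {w} {y} {x} sy⊆wx with ⊆-++⁻ w sy⊆wx
  ... | s₁ , s₂ , eq , s₁⊆w , s₂⊆x with ⊆-[ x ]⁻ s₂⊆x
  ...   | inj₁ refl = ⊆-trans (Sublistₚ.++⁺ʳ [ y ] ⊆-refl)
                              (subst (_⊆ w) (trans (sym (Listₚ.++-identityʳ s₁)) (sym eq)) s₁⊆w)
  ...   | inj₂ refl = subst (_⊆ w) (sym (Listₚ.∷ʳ-injectiveˡ s s₁ eq)) s₁⊆w

  Unique-resp-⊇ : ∀ {A : Set} {s w : List A} → s ⊆ w → Unique w → Unique s
  Unique-resp-⊇ []          _            = []
  Unique-resp-⊇ (_ ∷ʳ s⊆w)  (_ ∷ uw)     = Unique-resp-⊇ s⊆w uw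
  Unique-resp-⊇ (refl ∷ s⊆w) (x∉w ∷ uw)  = Sublistₚ.All-resp-⊆ s⊆w x∉w ∷ Unique-resp-⊇ s⊆w uw

  length-∷-mid : ∀ {A : Set} (u v : List A) {x} → length (u ++ x ∷ v) ≡ suc (length (u ++ v))
  length-∷-mid []      v = refl
  length-∷-mid (y ∷ u) v = cong suc (length-∷-mid u v)

  ++-∷-cancel : ∀ {A : Set} {x : A} u₁ u₂ {v₁ v₂} → x ∉ u₁ → x ∉ u₂ →
                u₁ ++ x ∷ v₁ ≡ u₂ ++ x ∷ v₂ → u₁ ≡ u₂ × v₁ ≡ v₂
  ++-∷-cancel []       []       _   _   eq = refl , Listₚ.∷-injectiveʳ eq
  ++-∷-cancel []       (y ∷ u₂) _   x∉₂ eq = ⊥-elim (x∉₂ (here (Listₚ.∷-injectiveˡ eq)))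
  ++-∷-cancel (y ∷ u₁) []       x∉₁ _   eq = ⊥-elim (x∉₁ (here (sym (Listₚ.∷-injectiveˡ eq))))
  ++-∷-cancel (y ∷ u₁) (z ∷ u₂) x∉₁ x∉₂ eq with Listₚ.∷-injective eq
  ... | refl , eq′ = map₁ (cong (y ∷_)) (++-∷-cancel u₁ u₂ (x∉₁ ∘ there) (x∉₂ ∘ there) eq′)

  Unique-++-disjoint : ∀ {A : Set} u {w : List A} {x z} → Unique (u ++ w) → x ∈ u → z ∈ w → x ≢ z
  Unique-++-disjoint (y ∷ u) (y∉ ∷ _)  (here refl) z∈ = All.lookup (Allₚ.++⁻ʳ u y∉) z∈
  Unique-++-disjoint (y ∷ u) (_ ∷ uuw) (there x∈)  z∈ = Unique-++-disjoint u uuw x∈ z∈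

  Unique-resp-↭ : ∀ {A : Set} {xs ys : List A} → xs ↭ ys → Unique xs → Unique ys
  Unique-resp-↭ {A} xs↭ys = PermutationSetoidₚ.Unique-resp-↭ (setoid A) (↭⇒↭ₛ xs↭ys)

  ↭-drop-∷ʳ : ∀ {A : Set} {t : A} xs ys {zs} → xs ++ t ∷ ys ↭ zs ++ [ t ] → xs ++ ys ↭ zs
  ↭-drop-∷ʳ xs ys t↭ = ↭-trans (drop-mid xs _ t↭) (↭-reflexive (Listₚ.++-identityʳ _))

  unique-↭ : ∀ {A : Set} {xs ys : List A} → Unique xs → Unique ys →
             (∀ {z} → z ∈ xs → z ∈ ys) → (∀ {z} → z ∈ ys → z ∈ xs) → xs ↭ ys
  unique-↭ ux uy to from = ∼bag⇒↭ (unique∧set⇒bag ux uy (mk⇔ to from))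

  Unique-concatMap : ∀ {A B : Set} (f : A → List B) {xs} → Unique xs → All (Unique ∘ f) xs →
                     (∀ {x x′ w} → x ∈ xs → x′ ∈ xs → w ∈ f x → w ∈ f x′ → x ≡ x′) →
                     Unique (concatMap f xs)
  Unique-concatMap f []             []         _ = []
  Unique-concatMap f {x ∷ xs} (x∉xs ∷ uxs) (ufx ∷ ufxs) same =
    Uniqueₚ.++⁺ ufx (Unique-concatMap f uxs ufxs (λ i j → same (there i) (there j))) disjoint
    where
    disjoint : ∀ {w} → ¬ (w ∈ f x × w ∈ concatMap f xs)
    disjoint (w∈fx , w∈rest) with ∈-concat⁻′ (map f xs) w∈rest
    ... | _ , w∈ys , ys∈ with ∈-map⁻ f ys∈
    ...   | x′ , x′∈ , refl = All.lookup x∉xs x′∈ (same (here refl) (there x′∈) w∈fx w∈ys)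

  oneTo : ℕ → List ℕ
  oneTo = applyUpTo suc

  IsPermutation : List ℕ → Set
  IsPermutation σ = σ ↭ oneTo (length σ)

  ∈-oneTo⁻ : ∀ {n x} → x ∈ oneTo n → 0 < x × x ≤ n
  ∈-oneTo⁻ x∈ with ∈-applyUpTo⁻ suc x∈
  ... | i , i<n , refl = s≤s z≤n , i<n

  suc∈oneTo : ∀ n → suc n ∈ oneTo (suc n)
  suc∈oneTo n = ∈-applyUpTo⁺ suc (ℕₚ.n<1+n n)

  Unique-oneTo : ∀ n → Unique (oneTo n)
  Unique-oneTo n = Uniqueₚ.applyUpTo⁺₁ suc n (λ i<j _ i≡j → ℕₚ.<-irrefl (ℕₚ.suc-injective i≡j) i<j)

  oneTo-suc : ∀ n → oneTo (suc n) ≡ oneTo n ++ [ suc n ]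
  oneTo-suc n = sym (Listₚ.applyUpTo-∷ʳ suc n)

  ∈-insertAll⁻ : ∀ {x w} σ → w ∈ insertAll x σ → ∃₂ λ u v → w ≡ u ++ x ∷ v × σ ≡ u ++ v
  ∈-insertAll⁻ []       (here refl) = [] , [] , refl , refl
  ∈-insertAll⁻ (y ∷ σ) (here refl) = [] , y ∷ σ , refl , refl
  ∈-insertAll⁻ (y ∷ σ) (there w∈) with ∈-map⁻ (y ∷_) w∈
  ... | w′ , w′∈ , refl with ∈-insertAll⁻ σ w′∈
  ...   | u , v , refl , refl = y ∷ u , v , refl , refl

  ∈-insertAll⁺ : ∀ x u v → u ++ x ∷ v ∈ insertAll x (u ++ v)
  ∈-insertAll⁺ x []      []      = here refl
  ∈-insertAll⁺ x []      (y ∷ v) = here refl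
  ∈-insertAll⁺ x (y ∷ u) v       = there (∈-map⁺ (y ∷_) (∈-insertAll⁺ x u v))

  Unique-insertAll : ∀ {x} σ → x ∉ σ → Unique (insertAll x σ)
  Unique-insertAll []       _   = [] ∷ []
  Unique-insertAll (y ∷ σ) x∉ =
    Allₚ.map⁺ (All.tabulate (λ _ eq → x∉ (here (Listₚ.∷-injectiveˡ eq))))
    ∷ Uniqueₚ.map⁺ Listₚ.∷-injectiveʳ (Unique-insertAll σ (x∉ ∘ there))

  delete : ℕ → List ℕ → List ℕ
  delete x = filter (λ y → ¬? (y ℕₚ.≟ x))

  delete-∉ : ∀ {x} σ → x ∉ σ → delete x σ ≡ σ
  delete-∉ σ x∉ = Listₚ.filter-all _ (All.tabulate λ y∈ y≡x → x∉ (subst (_∈ σ) y≡x y∈))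

  delete-insert : ∀ {x} u v → x ∉ u ++ v → delete x (u ++ x ∷ v) ≡ u ++ v
  delete-insert {x} u v x∉ = begin
    delete x (u ++ x ∷ v)          ≡⟨ Listₚ.filter-++ _ u (x ∷ v) ⟩
    delete x u ++ delete x (x ∷ v) ≡⟨ cong (delete x u ++_) (Listₚ.filter-reject (λ y → ¬? (y ℕₚ.≟ x)) {xs = v} (λ x≢x → x≢x refl)) ⟩
    delete x u ++ delete x v       ≡⟨ cong₂ _++_ (delete-∉ u (x∉ ∘ ∈-++⁺ˡ)) (delete-∉ v (x∉ ∘ ∈-++⁺ʳ u)) ⟩
    u ++ v                         ∎
    where open ≡-Reasoning

  ∈-insertAll⇒delete : ∀ {x w} σ → x ∉ σ → w ∈ insertAll x σ → delete x w ≡ σ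
  ∈-insertAll⇒delete σ x∉ w∈ with ∈-insertAll⁻ σ w∈
  ... | u , v , refl , refl = delete-insert u v x∉

  S-sound : ∀ n {σ} → σ ∈ S n → σ ↭ oneTo n
  S-sound zero    (here refl) = ↭-refl
  S-sound (suc n) σ∈ with ∈-concat⁻′ (map (insertAll (suc n)) (S n)) σ∈
  ... | _ , σ∈ins , ins∈ with ∈-map⁻ (insertAll (suc n)) ins∈
  ...   | σ′ , σ′∈ , refl with ∈-insertAll⁻ σ′ σ∈ins
  ...     | u , v , refl , refl = begin
    u ++ suc n ∷ v      ↭⟨ shift (suc n) u v ⟩
    suc n ∷ u ++ v      ↭⟨ prep (suc n) (S-sound n σ′∈) ⟩
    suc n ∷ oneTo n     ↭⟨ ∷↭∷ʳ (suc n) (oneTo n) ⟩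
    oneTo n ++ [ suc n ] ≡⟨ oneTo-suc n ⟨
    oneTo (suc n)       ∎
    where open PermutationReasoning

  S-complete : ∀ n {σ} → σ ↭ oneTo n → σ ∈ S n
  S-complete zero    σ↭ rewrite ↭-empty-inv σ↭ = here refl
  S-complete (suc n) σ↭ with ∈-∃++ (∈-resp-↭ (↭-sym σ↭) (suc∈oneTo n))
  ... | u , v , refl = ∈-concat⁺′ (∈-insertAll⁺ (suc n) u v)
                         (∈-map⁺ _ (S-complete n (↭-drop-∷ʳ u v (↭-trans σ↭ (↭-reflexive (oneTo-suc n))))))

  ∈-S : ∀ n {σ} → σ ∈ S n → ∀ {x} → x ∈ σ → 0 < x × x ≤ n
  ∈-S n σ∈ x∈ = ∈-oneTo⁻ (∈-resp-↭ (S-sound n σ∈) x∈)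

  Unique-S : ∀ n → Unique (S n)
  Unique-S zero    = [] ∷ []
  Unique-S (suc n) = Unique-concatMap (insertAll (suc n)) (Unique-S n)
    (All.tabulate (λ σ∈ → Unique-insertAll _ (suc∉ σ∈)))
    (λ σ∈ σ′∈ w∈ w∈′ → trans (sym (∈-insertAll⇒delete _ (suc∉ σ∈) w∈)) (∈-insertAll⇒delete _ (suc∉ σ′∈) w∈′))
    where
    suc∉ : ∀ {σ} → σ ∈ S n → suc n ∉ σ
    suc∉ σ∈ x∈ = ℕₚ.<-irrefl refl (proj₂ (∈-S n σ∈ x∈))

  T⇒≡true : ∀ {b} → T b → b ≡ true
  T⇒≡true = Equivalence.to T-≡

  ¬T⇒≡false : ∀ {b} → ¬ T b → b ≡ false
  ¬T⇒≡false {false} _   = refl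
  ¬T⇒≡false {true}  ¬tt = ⊥-elim (¬tt _)

  <⇒<ᵇ≡true : ∀ {m n} → m < n → (m <ᵇ n) ≡ true
  <⇒<ᵇ≡true = T⇒≡true ∘ ℕₚ.<⇒<ᵇ

  ≮⇒<ᵇ≡false : ∀ {m n} → ¬ m < n → (m <ᵇ n) ≡ false
  ≮⇒<ᵇ≡false {m} {n} m≮n = ¬T⇒≡false (m≮n ∘ ℕₚ.<ᵇ⇒< m n)

  rank : List ℕ → ℕ → ℕ
  rank w a = suc (count (_<ᵇ a) w)

  countᵇ≡count : ∀ (p : ℕ → Bool) xs → countᵇ p xs ≡ count p xs
  countᵇ≡count p []       = refl
  countᵇ≡count p (x ∷ xs) with p x
  ... | true  = cong suc (countᵇ≡count p xs)
  ... | false = countᵇ≡count p xs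

  red≡map-rank : ∀ w → red w ≡ map (rank w) w
  red≡map-rank w = Listₚ.map-cong (λ a → cong suc (countᵇ≡count (_<ᵇ a) w)) w

  length-red : ∀ w → length (red w) ≡ length w
  length-red w = Listₚ.length-map _ w

  red-positive : ∀ w → All (0 <_) (red w)
  red-positive w = Allₚ.map⁺ (All.tabulate (λ _ → s≤s z≤n))

  red-[_] : ∀ x → red [ x ] ≡ [ 1 ]
  red-[ x ] rewrite ≮⇒<ᵇ≡false (ℕₚ.<-irrefl {x} refl) = refl

  rank≤length : ∀ {w a} → a ∈ w → rank w a ≤ length w
  rank≤length {x ∷ w} (here refl) rewrite ≮⇒<ᵇ≡false (ℕₚ.<-irrefl {x} refl) = s≤s (count≤length _ w)
  rank≤length {x ∷ w} {a} (there a∈) with x <ᵇ a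
  ... | true  = s≤s (rank≤length a∈)
  ... | false = ℕₚ.m≤n⇒m≤1+n (rank≤length a∈)

  _≪_ : List ℕ → List ℕ → Set
  u ≪ v = All (λ x → All (x <_) v) u

  ≪-resp-⊇ : ∀ {u v u′ v′} → u′ ⊆ u → v′ ⊆ v → u ≪ v → u′ ≪ v′
  ≪-resp-⊇ u′⊆u v′⊆v u≪v = All.map (Sublistₚ.All-resp-⊆ v′⊆v) (Sublistₚ.All-resp-⊆ u′⊆u u≪v)

  rank-++ : ∀ u v a → rank (u ++ v) a ≡ rank u a + count (_<ᵇ a) v
  rank-++ u v a = cong suc (count-++ (_<ᵇ a) u v)

  count-<ᵇ-below : ∀ {a v} → All (a <_) v → count (_<ᵇ a) v ≡ 0
  count-<ᵇ-below a<v = count-none _ (All.map (λ a<y → ≮⇒<ᵇ≡false (ℕₚ.<-asym a<y)) a<v)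

  count-<ᵇ-above : ∀ {a u} → All (_< a) u → count (_<ᵇ a) u ≡ length u
  count-<ᵇ-above u<a = count-all _ (All.map <⇒<ᵇ≡true u<a)

  _⊕_ : List ℕ → List ℕ → List ℕ
  p ⊕ q = p ++ map (length p +_) q

  _⊖_ : List ℕ → List ℕ → List ℕ
  p ⊖ q = map (length q +_) p ++ q

  red-++-≪ : ∀ u v → u ≪ v → red (u ++ v) ≡ red u ⊕ red v
  red-++-≪ u v u≪v = begin
    red (u ++ v)                                        ≡⟨ trans (red≡map-rank (u ++ v)) (Listₚ.map-++ _ u v) ⟩
    map (rank (u ++ v)) u ++ map (rank (u ++ v)) v      ≡⟨ cong₂ _++_ (Listₚ.map-cong-local (All.tabulate on-u))
                                                                      (Listₚ.map-cong-local (All.tabulate on-v)) ⟩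
    map (rank u) u ++ map ((length u +_) ∘ rank v) v   ≡⟨ cong₂ _++_ (sym (red≡map-rank u))
                                                                      (trans (Listₚ.map-∘ v) (cong (map _) (sym (red≡map-rank v)))) ⟩
    red u ++ map (length u +_) (red v)                  ≡⟨ cong (λ n → red u ++ map (n +_) (red v)) (length-red u) ⟨
    red u ⊕ red v                                       ∎
    where
    open ≡-Reasoning
    on-u : ∀ {a} → a ∈ u → rank (u ++ v) a ≡ rank u a
    on-u {a} a∈ = trans (rank-++ u v a) (trans (cong (rank u a +_) (count-<ᵇ-below {a} (All.lookup u≪v a∈))) (ℕₚ.+-identityʳ _))
    on-v : ∀ {a} → a ∈ v → rank (u ++ v) a ≡ length u + rank v a
    on-v {a} a∈ = trans (cong suc (trans (count-++ (_<ᵇ a) u v) (cong (_+ count (_<ᵇ a) v) (count-<ᵇ-above {a} (All.tabulate (λ x∈ → All.lookup (All.lookup u≪v x∈) a∈))))))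
                    (sym (ℕₚ.+-suc (length u) _))

  red-++-≫ : ∀ u v → v ≪ u → red (u ++ v) ≡ red u ⊖ red v
  red-++-≫ u v v≪u = begin
    red (u ++ v)                                        ≡⟨ trans (red≡map-rank (u ++ v)) (Listₚ.map-++ _ u v) ⟩
    map (rank (u ++ v)) u ++ map (rank (u ++ v)) v      ≡⟨ cong₂ _++_ (Listₚ.map-cong-local (All.tabulate on-u))
                                                                      (Listₚ.map-cong-local (All.tabulate on-v)) ⟩
    map ((length v +_) ∘ rank u) u ++ map (rank v) v   ≡⟨ cong₂ _++_ (trans (Listₚ.map-∘ u) (cong (map _) (sym (red≡map-rank u))))
                                                                      (sym (red≡map-rank v)) ⟩
    map (length v +_) (red u) ++ red v                  ≡⟨ cong (λ n → map (n +_) (red u) ++ red v) (length-red v) ⟨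
    red u ⊖ red v                                       ∎
    where
    open ≡-Reasoning
    on-u : ∀ {a} → a ∈ u → rank (u ++ v) a ≡ length v + rank u a
    on-u {a} a∈ = trans (rank-++ u v a) (trans (cong (rank u a +_) (count-<ᵇ-above {a} (All.tabulate (λ y∈ → All.lookup (All.lookup v≪u y∈) a∈))))
                    (ℕₚ.+-comm (rank u a) (length v)))
    on-v : ∀ {a} → a ∈ v → rank (u ++ v) a ≡ rank v a
    on-v {a} a∈ = cong suc (trans (count-++ (_<ᵇ a) u v) (cong (_+ count (_<ᵇ a) v) (count-<ᵇ-below {a} (All.lookup v≪u a∈))))

  OrderInvariant : (ℕ → ℕ) → Set
  OrderInvariant f = ∀ x y → (f x <ᵇ f y) ≡ (x <ᵇ y)

  +-orderInvariant : ∀ c → OrderInvariant (c +_)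
  +-orderInvariant zero    x y = refl
  +-orderInvariant (suc c) x y = +-orderInvariant c x y

  red-map : ∀ {f} → OrderInvariant f → ∀ w → red (map f w) ≡ red w
  red-map {f} f-inv w = begin
    red (map f w)                  ≡⟨ red≡map-rank (map f w) ⟩
    map (rank (map f w)) (map f w) ≡⟨ Listₚ.map-∘ w ⟨
    map (rank (map f w) ∘ f) w     ≡⟨ Listₚ.map-cong (λ a → cong suc (rank-invariant a)) w ⟩
    map (rank w) w                 ≡⟨ red≡map-rank w ⟨
    red w                          ∎
    where
    open ≡-Reasoning
    rank-invariant : ∀ a → count (_<ᵇ f a) (map f w) ≡ count (_<ᵇ a) w
    rank-invariant a = trans (count-map (_<ᵇ f a) f w) (count-cong w (λ {x} _ → f-inv x a))

  Contains : List ℕ → List ℕ → Set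
  Contains w p = ∃ λ s → s ⊆ w × red s ≡ p

  ==ᴸ⇒≡ : ∀ u v → T (u ==ᴸ v) → u ≡ v
  ==ᴸ⇒≡ u v t with Listₚ.≡-dec ℕₚ._≟_ u v
  ... | yes u≡v = u≡v

  ≡⇒==ᴸ : ∀ u v → u ≡ v → T (u ==ᴸ v)
  ≡⇒==ᴸ u v u≡v with Listₚ.≡-dec ℕₚ._≟_ u v
  ... | yes _   = _
  ... | no u≢v = u≢v u≡v

  contains⇒Contains : ∀ w p → T (contains w p) → Contains w p
  contains⇒Contains w p t with find (Anyₚ.any⁻ _ (subseqs w) t)
  ... | s , s∈ , s≡p = s , ∈-subseqs⇒⊆ w s∈ , ==ᴸ⇒≡ _ p s≡p

  Contains⇒contains : ∀ w p → Contains w p → T (contains w p)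
  Contains⇒contains w p (s , s⊆w , refl) = Anyₚ.any⁺ _ (lose (⊆⇒∈-subseqs s⊆w) (≡⇒==ᴸ (red s) (red s) refl))

  avoids⇒¬Contains : ∀ {w p} → T (avoids w p) → ¬ Contains w p
  avoids⇒¬Contains {w} {p} t c = subst (T ∘ not) (T⇒≡true (Contains⇒contains w p c)) t

  ¬Contains⇒avoids : ∀ {w p} → ¬ Contains w p → T (avoids w p)
  ¬Contains⇒avoids {w} {p} ¬c = subst (T ∘ not) (sym (¬T⇒≡false (¬c ∘ contains⇒Contains w p))) _

  Contains-⊆ : ∀ {w w′ p} → w ⊆ w′ → Contains w p → Contains w′ p
  Contains-⊆ w⊆w′ (s , s⊆w , s≡p) = s , ⊆-trans s⊆w w⊆w′ , s≡p

  Contains-map⁺ : ∀ {f} → OrderInvariant f → ∀ {w p} → Contains w p → Contains (map f w) p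
  Contains-map⁺ {f} f-inv (s , s⊆w , s≡p) = map f s , Sublistₚ.map⁺ f s⊆w , trans (red-map f-inv s) s≡p

  Contains-map⁻ : ∀ {f} → OrderInvariant f → ∀ w {p} → Contains (map f w) p → Contains w p
  Contains-map⁻ {f} f-inv w (s , s⊆ , s≡p) with ⊆-map⁻ f w s⊆
  ... | s′ , refl , s′⊆w = s′ , s′⊆w , trans (sym (red-map f-inv s′)) s≡p

  ⊔-fold-upper : ∀ xs {x} → x ∈ xs → x ≤ foldr _⊔_ 0 xs
  ⊔-fold-upper (y ∷ xs) (here refl) = ℕₚ.m≤m⊔n y _
  ⊔-fold-upper (y ∷ xs) (there x∈) = ℕₚ.≤-trans (⊔-fold-upper xs x∈) (ℕₚ.m≤n⊔m y _)

  ⊔-fold-sel : ∀ xs → foldr _⊔_ 0 xs ≡ 0 ⊎ foldr _⊔_ 0 xs ∈ xs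
  ⊔-fold-sel []       = inj₁ refl
  ⊔-fold-sel (y ∷ xs) with ℕₚ.⊔-sel y (foldr _⊔_ 0 xs) | ⊔-fold-sel xs
  ... | inj₁ eq | _         = inj₂ (here eq)
  ... | inj₂ eq | inj₁ eq′  = inj₁ (trans eq eq′)
  ... | inj₂ eq | inj₂ m∈xs = inj₂ (there (subst (_∈ xs) (sym eq) m∈xs))

  Increasing : List ℕ → Set
  Increasing s = T (increasing s)

  lis-upper : ∀ {s w} → s ⊆ w → Increasing s → length s ≤ lis w
  lis-upper {s} {w} s⊆w inc = ⊔-fold-upper (map length (filterᵇ increasing (subseqs w)))
    (∈-map⁺ length (∈-filter⁺ (T? ∘ increasing) (⊆⇒∈-subseqs s⊆w) inc))

  lis-witness : ∀ w → ∃ λ s → s ⊆ w × Increasing s × length s ≡ lis w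
  lis-witness w with ⊔-fold-sel (map length (filterᵇ increasing (subseqs w)))
  ... | inj₁ lis≡0 = [] , minimum w , _ , sym lis≡0
  ... | inj₂ lis∈ with ∈-map⁻ length lis∈
  ...   | s , s∈ , lis≡ with ∈-filter⁻ (T? ∘ increasing) s∈
  ...     | s∈′ , inc = s , ∈-subseqs⇒⊆ w s∈′ , inc , sym lis≡

  lis-≤ : ∀ {w N} → (∀ {s} → s ⊆ w → Increasing s → length s ≤ N) → lis w ≤ N
  lis-≤ {w} upper with lis-witness w
  ... | s , s⊆w , inc , s≡lis = subst (_≤ _) s≡lis (upper s⊆w inc)

  lis-mono : ∀ {s w} → s ⊆ w → lis s ≤ lis w
  lis-mono s⊆w = lis-≤ (λ t⊆s → lis-upper (⊆-trans t⊆s s⊆w))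

  lis≤length : ∀ w → lis w ≤ length w
  lis≤length w = lis-≤ {w} (λ s⊆w _ → Sublistₚ.length-mono-≤ s⊆w)

  increasing-map : ∀ {f} → OrderInvariant f → ∀ w → increasing (map f w) ≡ increasing w
  increasing-map f-inv []          = refl
  increasing-map f-inv (x ∷ [])    = refl
  increasing-map f-inv (x ∷ y ∷ w) = cong₂ _∧_ (f-inv x y) (increasing-map f-inv (y ∷ w))

  increasing-∷∷⁻ : ∀ {x y w} → Increasing (x ∷ y ∷ w) → x < y × Increasing (y ∷ w)
  increasing-∷∷⁻ {x} {y} {w} inc with Equivalence.to (T-∧ {x <ᵇ y} {increasing (y ∷ w)}) inc
  ... | x<ᵇy , inc′ = ℕₚ.<ᵇ⇒< x y x<ᵇy , inc′

  increasing-∷∷⁺ : ∀ {x y w} → x < y → Increasing (y ∷ w) → Increasing (x ∷ y ∷ w)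
  increasing-∷∷⁺ x<y inc = Equivalence.from T-∧ (ℕₚ.<⇒<ᵇ x<y , inc)

  increasing-∷⁻ : ∀ {x} w → Increasing (x ∷ w) → All (x <_) w × Increasing w
  increasing-∷⁻ []      _   = [] , _
  increasing-∷⁻ (y ∷ w) inc =
    x<y ∷ All.map (ℕₚ.<-trans x<y) (proj₁ (increasing-∷⁻ w inc′)) , inc′
    where
    x<y = proj₁ (increasing-∷∷⁻ {w = w} inc)
    inc′ = proj₂ (increasing-∷∷⁻ {w = w} inc)

  increasing-++⁻ : ∀ u {v} → Increasing (u ++ v) → Increasing u × Increasing v
  increasing-++⁻ []          inc = _ , inc
  increasing-++⁻ (x ∷ [])    {v} inc = _ , proj₂ (increasing-∷⁻ v inc)
  increasing-++⁻ (x ∷ y ∷ u) {v} inc =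
    map₁ (increasing-∷∷⁺ {w = u} (proj₁ (increasing-∷∷⁻ {w = u ++ v} inc)))
         (increasing-++⁻ (y ∷ u) (proj₂ (increasing-∷∷⁻ {w = u ++ v} inc)))

  increasing-++⁺ : ∀ u {v} → Increasing u → Increasing v → u ≪ v → Increasing (u ++ v)
  increasing-++⁺ []          _     inc-v _                          = inc-v
  increasing-++⁺ (x ∷ [])    {[]}    _ _ _                         = _
  increasing-++⁺ (x ∷ [])    {y ∷ v} _ inc-v ((x<y ∷ _) ∷ [])      = increasing-∷∷⁺ {w = v} x<y inc-v
  increasing-++⁺ (x ∷ y ∷ u) {v} inc-u inc-v (_ ∷ u≪v) =
    increasing-∷∷⁺ {w = u ++ v} (proj₁ (increasing-∷∷⁻ {w = u} inc-u))
      (increasing-++⁺ (y ∷ u) (proj₂ (increasing-∷∷⁻ {w = u} inc-u)) inc-v u≪v)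

  lis-map : ∀ {f} → OrderInvariant f → ∀ w → lis (map f w) ≡ lis w
  lis-map {f} f-inv w = ℕₚ.≤-antisym (lis-≤ upper) (lis-≤ lower)
    where
    upper : ∀ {s} → s ⊆ map f w → Increasing s → length s ≤ lis w
    upper s⊆ inc with ⊆-map⁻ f w s⊆
    ... | s′ , refl , s′⊆w = subst (_≤ lis w) (sym (Listₚ.length-map f s′))
                               (lis-upper s′⊆w (subst T (increasing-map f-inv s′) inc))
    lower : ∀ {s} → s ⊆ w → Increasing s → length s ≤ lis (map f w)
    lower {s} s⊆w inc = subst (_≤ _) (Listₚ.length-map f s)
      (lis-upper (Sublistₚ.map⁺ f s⊆w) (subst T (sym (increasing-map f-inv s)) inc))

  SumIndecomposable : List ℕ → Set
  SumIndecomposable p = ∀ {x s y t} → p ≢ red (x ∷ s) ⊕ red (y ∷ t)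

  Contains-++-≪ : ∀ {u v p} → SumIndecomposable p → u ≪ v → Contains (u ++ v) p → Contains u p ⊎ Contains v p
  Contains-++-≪ {u} {v} indec u≪v (s , s⊆uv , s≡p) with ⊆-++⁻ u s⊆uv
  ... | []    , s₂     , refl , _    , s₂⊆v = inj₂ (s₂ , s₂⊆v , s≡p)
  ... | s₁    , []     , refl , s₁⊆u , _    = inj₁ (s₁ , s₁⊆u , trans (cong red (sym (Listₚ.++-identityʳ s₁))) s≡p)
  ... | x ∷ s₁ , y ∷ s₂ , refl , s₁⊆u , s₂⊆v =
    ⊥-elim (indec (trans (sym s≡p) (red-++-≪ (x ∷ s₁) (y ∷ s₂) (≪-resp-⊇ s₁⊆u s₂⊆v u≪v))))

  ∈-last : ∀ {A : Set} xs {y ys} zs {a : A} → xs ++ y ∷ ys ≡ zs ++ [ a ] → a ∈ y ∷ ys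
  ∈-last []       zs eq = subst (_ ∈_) (sym eq) (∈-++⁺ʳ zs (here refl))
  ∈-last (x ∷ xs) (z ∷ zs) eq = ∈-last xs zs (Listₚ.∷-injectiveʳ eq)
  ∈-last (x ∷ xs) {y} {ys} [] eq with Listₚ.++-conicalʳ xs (y ∷ ys) (Listₚ.∷-injectiveʳ eq)
  ... | ()

  ∷ʳ1-sumIndecomposable : ∀ q → SumIndecomposable (q ++ [ 1 ])
  ∷ʳ1-sumIndecomposable q {x} {s} {y} {t} eq with ∈-map⁻ _ (∈-last (red (x ∷ s)) q (sym eq))
  ... | r , r∈ , 1≡ with All.lookup (red-positive (y ∷ t)) r∈
  ...   | s≤s _ = ℕₚ.m+1+n≢0 _ (sym (ℕₚ.suc-injective 1≡))

  length-⊕ : ∀ p q → length (p ⊕ q) ≡ length p + length q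
  length-⊕ p q = trans (Listₚ.length-++ p) (cong (length p +_) (Listₚ.length-map _ q))

  max∷-sumIndecomposable : ∀ q → SumIndecomposable (suc (length q) ∷ q)
  max∷-sumIndecomposable q {x} {s} {y} {t} eq = ℕₚ.<-irrefl refl (ℕₚ.≤-<-trans first≤ (ℕₚ.<-≤-trans s<p (ℕₚ.≤-reflexive (sym p≡))))
    where
    p≡ : suc (length q) ≡ suc (length s) + suc (length t)
    p≡ = trans (cong length eq) (trans (length-⊕ (red (x ∷ s)) _) (cong₂ _+_ (length-red (x ∷ s)) (length-red (y ∷ t))))
    first≤ : suc (length q) ≤ suc (length s)
    first≤ = subst (_≤ suc (length s)) (sym (Listₚ.∷-injectiveˡ (trans eq (cong (_⊕ red (y ∷ t)) (red≡map-rank (x ∷ s))))))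
                   (rank≤length {x ∷ s} (here refl))
    s<p : suc (length s) < suc (length s) + suc (length t)
    s<p = ℕₚ.m<m+n (suc (length s)) (s≤s z≤n)

  312-sumIndecomposable : SumIndecomposable p312
  312-sumIndecomposable = max∷-sumIndecomposable (1 ∷ 2 ∷ [])

  -- Appending a new minimum: the reduced form of ρ1 is red ρ ⊖1.
  _⊖1 : List ℕ → List ℕ
  q ⊖1 = q ⊖ [ 1 ]

  ⊖1≢[] : ∀ q → q ⊖1 ≢ []
  ⊖1≢[] q eq with Listₚ.++-conicalʳ (map suc q) [ 1 ] eq
  ... | ()

  red-∷ʳ-min : ∀ {x} w → All (x <_) w → red (w ++ [ x ]) ≡ red w ⊖1
  red-∷ʳ-min {x} w x<w = trans (red-++-≫ w [ x ] (x<w ∷ [])) (cong (red w ⊖_) red-[ x ])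

  Contains-∷ʳ-min : ∀ {x w p} → All (x <_) w → Contains (w ++ [ x ]) p → Contains w p ⊎ ∃ λ q → p ≡ q ++ [ 1 ]
  Contains-∷ʳ-min {x} {w} x<w (s , s⊆ , s≡p) with ⊆-++⁻ w s⊆
  ... | s₁ , s₂ , refl , s₁⊆w , s₂⊆x with ⊆-[ x ]⁻ s₂⊆x
  ...   | inj₁ refl = inj₁ (s₁ , s₁⊆w , trans (cong red (sym (Listₚ.++-identityʳ s₁))) s≡p)
  ...   | inj₂ refl = inj₂ (map suc (red s₁) , trans (sym s≡p) (red-∷ʳ-min s₁ (Sublistₚ.All-resp-⊆ s₁⊆w x<w)))

  red-∷ʳ-min⁻ : ∀ r {y q} → Unique (r ++ [ y ]) → red (r ++ [ y ]) ≡ q ⊖1 → red r ≡ q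
  red-∷ʳ-min⁻ r {y} {q} unique eq = Listₚ.map-injective ℕₚ.suc-injective
    (Listₚ.∷ʳ-injectiveˡ (map suc (red r)) (map suc q) (trans (sym (red-∷ʳ-min r y<r)) eq))
    where
    rank-y≡1 : rank (r ++ [ y ]) y ≡ 1
    rank-y≡1 = Listₚ.∷ʳ-injectiveʳ (map (rank (r ++ [ y ])) r) (map suc q)
      (trans (sym (trans (red≡map-rank (r ++ [ y ])) (Listₚ.map-++ _ r [ y ]))) eq)
    nothing-below-y : All (λ z → (z <ᵇ y) ≡ false) r
    nothing-below-y = count≡0⇒none _ r (ℕₚ.m+n≡0⇒m≡0 _ (trans (sym (count-++ (_<ᵇ y) r [ y ])) (ℕₚ.suc-injective rank-y≡1)))
    y<r : All (y <_) r
    y<r = All.zipWith (λ (z≮y , z≢y) → ℕₚ.≤∧≢⇒< (ℕₚ.≮⇒≥ (λ z<y → subst T z≮y (ℕₚ.<⇒<ᵇ z<y))) (z≢y ∘ sym))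
            (nothing-below-y , All.tabulate (λ z∈ → Unique-++-disjoint r unique z∈ (here refl)))

  Contains-⊖1⁻ : ∀ {x w q} → Unique (w ++ [ x ]) → Contains (w ++ [ x ]) (q ⊖1) → Contains w q
  Contains-⊖1⁻ {q = q} unique (s , s⊆ , s≡) with initLast s
  ... | []       with Listₚ.++-conicalʳ (map suc q) [ 1 ] (sym s≡)
  ...   | ()
  Contains-⊖1⁻ unique (.(r ++ [ y ]) , s⊆ , s≡) | r ∷ʳ′ y =
    r , ∷ʳ-⊆-∷ʳ⁻ s⊆ , red-∷ʳ-min⁻ r (Unique-resp-⊇ s⊆ unique) s≡

  Contains-⊖1⁺ : ∀ {x w q} → All (x <_) w → Contains w q → Contains (w ++ [ x ]) (q ⊖1)
  Contains-⊖1⁺ x<w (r , r⊆w , refl) =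
    r ++ [ _ ] , Sublistₚ.++⁺ r⊆w ⊆-refl , red-∷ʳ-min r (Sublistₚ.All-resp-⊆ r⊆w x<w)

  lis-++-≪ : ∀ {u v} → u ≪ v → lis (u ++ v) ≡ lis u + lis v
  lis-++-≪ {u} {v} u≪v = ℕₚ.≤-antisym (lis-≤ upper) lower
    where
    upper : ∀ {s} → s ⊆ u ++ v → Increasing s → length s ≤ lis u + lis v
    upper s⊆ inc with ⊆-++⁻ u s⊆
    ... | s₁ , s₂ , refl , s₁⊆u , s₂⊆v with increasing-++⁻ s₁ inc
    ...   | inc₁ , inc₂ = subst (_≤ _) (sym (Listₚ.length-++ s₁)) (ℕₚ.+-mono-≤ (lis-upper s₁⊆u inc₁) (lis-upper s₂⊆v inc₂))
    lower : lis u + lis v ≤ lis (u ++ v)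
    lower with lis-witness u | lis-witness v
    ... | s₁ , s₁⊆u , inc₁ , s₁≡lis | s₂ , s₂⊆v , inc₂ , s₂≡lis =
      subst (_≤ _) (trans (Listₚ.length-++ s₁) (cong₂ _+_ s₁≡lis s₂≡lis))
        (lis-upper (Sublistₚ.++⁺ s₁⊆u s₂⊆v) (increasing-++⁺ s₁ inc₁ inc₂ (≪-resp-⊇ s₁⊆u s₂⊆v u≪v)))

  lis-∷ʳ-min : ∀ {x w} → All (x <_) w → lis (w ++ [ x ]) ≡ lis w ⊔ 1
  lis-∷ʳ-min {x} {w} x<w = ℕₚ.≤-antisym (lis-≤ upper)
    (ℕₚ.⊔-lub (lis-mono {w} (Sublistₚ.++⁺ʳ [ x ] ⊆-refl)) (lis-upper {[ x ]} (Sublistₚ.++⁺ˡ w ⊆-refl) _))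
    where
    ending-in-x : ∀ s → s ⊆ w → Increasing (s ++ [ x ]) → length (s ++ [ x ]) ≤ lis w ⊔ 1
    ending-in-x []      _      _   = ℕₚ.m≤n⊔m (lis w) 1
    ending-in-x (z ∷ s) z∷s⊆w inc = ⊥-elim (ℕₚ.<-asym x<z z<x)
      where
      x<z = All.lookup x<w (Sublistₚ.Any-resp-⊆ z∷s⊆w (here refl))
      z<x = All.lookup (proj₁ (increasing-∷⁻ (s ++ [ x ]) inc)) (∈-++⁺ʳ s (here refl))
    upper : ∀ {s} → s ⊆ w ++ [ x ] → Increasing s → length s ≤ lis w ⊔ 1
    upper s⊆ inc with ⊆-++⁻ w s⊆
    ... | s₁ , s₂ , refl , s₁⊆w , s₂⊆x with ⊆-[ x ]⁻ s₂⊆x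
    ...   | inj₁ refl = ℕₚ.≤-trans (lis-upper (subst (_⊆ w) (sym (Listₚ.++-identityʳ s₁)) s₁⊆w) inc)
                                   (ℕₚ.m≤m⊔n (lis w) 1)
    ...   | inj₂ refl = ending-in-x s₁ s₁⊆w inc

  oneTo-suc′ : ∀ n → oneTo (suc n) ≡ 1 ∷ map suc (oneTo n)
  oneTo-suc′ n = cong (1 ∷_) (sym (Listₚ.map-applyUpTo suc suc n))

  oneTo-+ : ∀ a b → oneTo (a + b) ≡ oneTo a ++ map (a +_) (oneTo b)
  oneTo-+ zero    b = sym (Listₚ.map-id (oneTo b))
  oneTo-+ (suc a) b = begin
    oneTo (suc a + b)                                       ≡⟨ oneTo-suc′ (a + b) ⟩
    1 ∷ map suc (oneTo (a + b))                             ≡⟨ cong (λ xs → 1 ∷ map suc xs) (oneTo-+ a b) ⟩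
    1 ∷ map suc (oneTo a ++ map (a +_) (oneTo b))           ≡⟨ cong (1 ∷_) (Listₚ.map-++ suc (oneTo a) _) ⟩
    1 ∷ map suc (oneTo a) ++ map suc (map (a +_) (oneTo b)) ≡⟨ cong₂ (λ xs ys → 1 ∷ xs ++ ys) refl (sym (Listₚ.map-∘ (oneTo b))) ⟩
    (1 ∷ map suc (oneTo a)) ++ map (suc a +_) (oneTo b)     ≡⟨ cong (_++ map (suc a +_) (oneTo b)) (oneTo-suc′ a) ⟨
    oneTo (suc a) ++ map (suc a +_) (oneTo b)               ∎
    where open ≡-Reasoning

  length-oneTo : ∀ n → length (oneTo n) ≡ n
  length-oneTo = Listₚ.length-applyUpTo suc

  length-↭-oneTo : ∀ {n σ} → σ ↭ oneTo n → length σ ≡ n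
  length-↭-oneTo {n} σ↭ = trans (↭-length σ↭) (length-oneTo n)

  ∈-↭-oneTo : ∀ {n σ} → σ ↭ oneTo n → All (λ x → 0 < x × x ≤ n) σ
  ∈-↭-oneTo σ↭ = All.tabulate (λ x∈ → ∈-oneTo⁻ (∈-resp-↭ σ↭ x∈))

  Unique-↭-oneTo : ∀ {n σ} → σ ↭ oneTo n → Unique σ
  Unique-↭-oneTo {n} σ↭ = Unique-resp-↭ (↭-sym σ↭) (Unique-oneTo n)

  map+-oneTo-suc : ∀ c N → map (c +_) (oneTo (suc N)) ≡ map (c +_) (oneTo N) ++ [ c + suc N ]
  map+-oneTo-suc c N = trans (cong (map (c +_)) (oneTo-suc N)) (Listₚ.map-++ (c +_) (oneTo N) _)

  length-↭-map+oneTo : ∀ {c N σ} → σ ↭ map (c +_) (oneTo N) → length σ ≡ N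
  length-↭-map+oneTo {c} {N} σ↭ = trans (↭-length σ↭) (trans (Listₚ.length-map (c +_) (oneTo N)) (length-oneTo N))

  ∈-map+oneTo⁻ : ∀ {c N x} → x ∈ map (c +_) (oneTo N) → x ≤ c + N
  ∈-map+oneTo⁻ {c} x∈ with ∈-map⁻ (c +_) x∈
  ... | y , y∈ , refl = ℕₚ.+-monoʳ-≤ c (proj₂ (∈-oneTo⁻ y∈))

  -- Induct on N: the largest entry c + N + 1 lies in the upper part v, unless v is empty.
  split-↭ : ∀ c N {u v} → u ++ v ↭ map (c +_) (oneTo N) → u ≪ v →
            u ↭ map (c +_) (oneTo (length u)) × v ↭ map ((c + length u) +_) (oneTo (length v))
  split-↭ c zero {u} {v} uv↭ _ with ↭-empty-inv uv↭
  ... | uv≡[] rewrite Listₚ.++-conicalˡ u v uv≡[] | Listₚ.++-conicalʳ u v uv≡[] = ↭-refl , ↭-refl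
  split-↭ c (suc N) {u} {v} uv↭ u≪v
    with ∈-++⁻ u (∈-resp-↭ (↭-sym (↭-trans uv↭ (↭-reflexive (map+-oneTo-suc c N)))) (∈-++⁺ʳ _ (here refl)))
  split-↭ c (suc N) {u} {[]} uv↭ u≪v | inj₁ _ =
    subst (λ n → u ↭ map (c +_) (oneTo n)) (sym (length-↭-map+oneTo u↭)) u↭ , ↭-refl
    where
    u↭ : u ↭ map (c +_) (oneTo (suc N))
    u↭ = ↭-trans (↭-reflexive (sym (Listₚ.++-identityʳ u))) uv↭
  split-↭ c (suc N) {u} {y ∷ _} uv↭ u≪v | inj₁ t∈u =
    ⊥-elim (ℕₚ.<-irrefl refl (ℕₚ.<-≤-trans (All.lookup (All.lookup u≪v t∈u) (here refl))
                                            (∈-map+oneTo⁻ (∈-resp-↭ uv↭ (∈-++⁺ʳ u (here refl))))))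
  split-↭ c (suc N) {u} {v} uv↭ u≪v | inj₂ t∈v with ∈-∃++ t∈v
  ... | v₁ , v₂ , refl = u↭ , v↭
    where
    t = c + suc N
    rest↭ : u ++ v₁ ++ v₂ ↭ map (c +_) (oneTo N)
    rest↭ = ↭-trans (↭-reflexive (sym (Listₚ.++-assoc u v₁ v₂)))
              (↭-drop-∷ʳ (u ++ v₁) v₂ (↭-trans (↭-reflexive (Listₚ.++-assoc u v₁ (t ∷ v₂)))
                                               (↭-trans uv↭ (↭-reflexive (map+-oneTo-suc c N)))))
    ih = split-↭ c N rest↭ (All.map (Sublistₚ.All-resp-⊆ (Sublistₚ.++⁺ ⊆-refl (t ∷ʳ ⊆-refl))) u≪v)
    u↭ = proj₁ ih
    L = length (v₁ ++ v₂)
    t≡ : t ≡ (c + length u) + suc L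
    t≡ = trans (cong (λ n → c + suc n) (sym (trans (sym (Listₚ.length-++ u)) (length-↭-map+oneTo rest↭))))
               (trans (cong (c +_) (sym (ℕₚ.+-suc (length u) L))) (sym (ℕₚ.+-assoc c (length u) (suc L))))
    v↭ : v₁ ++ t ∷ v₂ ↭ map ((c + length u) +_) (oneTo (length (v₁ ++ t ∷ v₂)))
    v↭ = begin
      v₁ ++ t ∷ v₂                                         ↭⟨ shift t v₁ v₂ ⟩
      t ∷ v₁ ++ v₂                                         ↭⟨ prep t (proj₂ ih) ⟩
      t ∷ map ((c + length u) +_) (oneTo L)                ↭⟨ ∷↭∷ʳ t _ ⟩
      map ((c + length u) +_) (oneTo L) ++ [ t ]           ≡⟨ trans (map+-oneTo-suc (c + length u) L) (cong (λ x → map ((c + length u) +_) (oneTo L) ++ [ x ]) (sym t≡)) ⟨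
      map ((c + length u) +_) (oneTo (suc L))              ≡⟨ cong (λ n → map ((c + length u) +_) (oneTo n)) (length-∷-mid v₁ v₂) ⟨
      map ((c + length u) +_) (oneTo (length (v₁ ++ t ∷ v₂))) ∎
      where open PermutationReasoning

  length-⊖1 : ∀ q → length (q ⊖1) ≡ suc (length q)
  length-⊖1 q = trans (Listₚ.length-++ (map suc q)) (trans (ℕₚ.+-comm _ 1) (cong suc (Listₚ.length-map suc q)))

  ⊖1⊕≡ : ∀ α β → (α ⊖1) ⊕ β ≡ map suc α ++ 1 ∷ map (suc (length α) +_) β
  ⊖1⊕≡ α β = trans (Listₚ.++-assoc (map suc α) [ 1 ] _) (cong (λ n → map suc α ++ 1 ∷ map (n +_) β) (length-⊖1 α))

  ⊖1⊕-↭ : ∀ {a b α β} → α ↭ oneTo a → β ↭ oneTo b → (α ⊖1) ⊕ β ↭ oneTo (suc (a + b))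
  ⊖1⊕-↭ {a} {b} {α} {β} α↭ β↭ = begin
    (α ⊖1) ⊕ β                                            ≡⟨ ⊖1⊕≡ α β ⟩
    map suc α ++ 1 ∷ map (suc (length α) +_) β            ≡⟨ cong (λ n → map suc α ++ 1 ∷ map (suc n +_) β) (length-↭-oneTo α↭) ⟩
    map suc α ++ 1 ∷ map (suc a +_) β                     ↭⟨ ++⁺ (map⁺ suc α↭) (prep 1 (map⁺ (suc a +_) β↭)) ⟩
    map suc (oneTo a) ++ 1 ∷ map (suc a +_) (oneTo b)     ↭⟨ shift 1 (map suc (oneTo a)) _ ⟩
    1 ∷ map suc (oneTo a) ++ map (suc ∘ (a +_)) (oneTo b) ≡⟨ cong (1 ∷_) (trans (cong (map suc (oneTo a) ++_) (Listₚ.map-∘ (oneTo b)))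
                                                                               (sym (Listₚ.map-++ suc (oneTo a) _))) ⟩
    1 ∷ map suc (oneTo a ++ map (a +_) (oneTo b))         ≡⟨ cong (λ xs → 1 ∷ map suc xs) (oneTo-+ a b) ⟨
    1 ∷ map suc (oneTo (a + b))                           ≡⟨ oneTo-suc′ (a + b) ⟨
    oneTo (suc (a + b))                                   ∎
    where open PermutationReasoning

  red-x1y : ∀ {x y} → 1 < y → y < x → red (x ∷ 1 ∷ y ∷ []) ≡ p312
  red-x1y {x} {y} 1<y y<x
    rewrite ≮⇒<ᵇ≡false (ℕₚ.<-irrefl {x} refl) | <⇒<ᵇ≡true (ℕₚ.<-trans 1<y y<x) | <⇒<ᵇ≡true y<x
          | ≮⇒<ᵇ≡false (ℕₚ.<-asym (ℕₚ.<-trans 1<y y<x)) | ≮⇒<ᵇ≡false (ℕₚ.<-asym 1<y)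
          | ≮⇒<ᵇ≡false (ℕₚ.<-asym y<x) | <⇒<ᵇ≡true 1<y | ≮⇒<ᵇ≡false (ℕₚ.<-irrefl {y} refl) = refl

  -- Otherwise some x left of 1 and y < x right of it would form a 312.
  312-avoiding-split : ∀ {u v} → Unique (u ++ 1 ∷ v) → All (0 <_) v → ¬ Contains (u ++ 1 ∷ v) p312 → u ≪ v
  312-avoiding-split {u} {v} unique 0<v avoid = All.tabulate λ x∈ → All.tabulate λ y∈ → below x∈ y∈
    where
    below : ∀ {x y} → x ∈ u → y ∈ v → x < y
    below {x} {y} x∈ y∈ with ℕₚ.<-cmp x y
    ... | tri< x<y _ _ = x<y
    ... | tri≈ _ x≡y _ = ⊥-elim (Unique-++-disjoint u unique x∈ (there y∈) x≡y)
    ... | tri> _ _ y<x = ⊥-elim (avoid (x ∷ 1 ∷ y ∷ [] , Sublistₚ.++⁺ (from∈ x∈) (refl ∷ from∈ y∈) , red-x1y 1<y y<x))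
      where
      1≢y : 1 ≢ y
      1≢y = Unique-++-disjoint [ 1 ] (Unique-resp-⊇ (Sublistₚ.++⁺ˡ u ⊆-refl) unique) (here refl) y∈
      1<y : 1 < y
      1<y = ℕₚ.≤∧≢⇒< (All.lookup 0<v y∈) 1≢y

  split-at-1 : ∀ n {u v} → u ++ 1 ∷ v ↭ oneTo (suc n) → ¬ Contains (u ++ 1 ∷ v) p312 →
               u ↭ map suc (oneTo (length u)) × v ↭ map (suc (length u) +_) (oneTo (length v))
  split-at-1 n {u} {v} σ↭ avoid = split-↭ 1 n uv↭ u≪v
    where
    uv↭ : u ++ v ↭ map suc (oneTo n)
    uv↭ = drop-mid u [] (↭-trans σ↭ (↭-reflexive (oneTo-suc′ n)))
    u≪v : u ≪ v
    u≪v = 312-avoiding-split (Unique-↭-oneTo σ↭) (All.map proj₁ (All.tail (Allₚ.++⁻ʳ u (∈-↭-oneTo σ↭)))) avoid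

  decompose : ∀ n {σ} → σ ↭ oneTo (suc n) → ¬ Contains σ p312 →
              ∃₂ λ α β → IsPermutation α × IsPermutation β × length α + length β ≡ n × σ ≡ (α ⊖1) ⊕ β
  decompose n {σ} σ↭ avoid with ∈-∃++ (∈-resp-↭ (↭-sym σ↭) (here refl))
  ... | u , v , refl with split-at-1 n σ↭ avoid
  ...   | u↭ , v↭ with ↭-map-inv suc (↭-sym u↭) | ↭-map-inv (suc (length u) +_) (↭-sym v↭)
  ...     | α , refl , oneTo↭α | β , refl , oneTo↭β =
    α , β , α↭ , β↭ , lengths , sym (trans (⊖1⊕≡ α β) (cong (λ l → map suc α ++ 1 ∷ map (suc l +_) β) (sym |u|≡|α|)))
    where
    |u|≡|α| : length (map suc α) ≡ length α
    |u|≡|α| = Listₚ.length-map suc α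
    |v|≡|β| : length (map (suc (length (map suc α)) +_) β) ≡ length β
    |v|≡|β| = Listₚ.length-map _ β
    α↭ : IsPermutation α
    α↭ = subst (λ l → α ↭ oneTo l) |u|≡|α| (↭-sym oneTo↭α)
    β↭ : IsPermutation β
    β↭ = subst (λ l → β ↭ oneTo l) |v|≡|β| (↭-sym oneTo↭β)
    lengths : length α + length β ≡ n
    lengths = trans (sym (cong₂ _+_ |u|≡|α| |v|≡|β|))
                (trans (sym (Listₚ.length-++ (map suc α)))
                       (ℕₚ.suc-injective (trans (sym (length-∷-mid (map suc α) _)) (length-↭-oneTo σ↭))))

  ≪-map+ : ∀ {c u w} → All (_≤ c) u → All (0 <_) w → u ≪ map (c +_) w
  ≪-map+ {c} u≤c 0<w = All.map (λ x≤c → Allₚ.map⁺ (All.map (λ 0<y → ℕₚ.≤-<-trans x≤c (ℕₚ.m<m+n c 0<y)) 0<w)) u≤c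

  module _ {α β} (α-perm : IsPermutation α) (β-perm : IsPermutation β) where

    private
      left  = α ⊖1
      right = map (length left +_) β

      1<suc-α : All (1 <_) (map suc α)
      1<suc-α = Allₚ.map⁺ (All.map (s≤s ∘ proj₁) (∈-↭-oneTo α-perm))

      left≪right : left ≪ right
      left≪right = ≪-map+ (subst (λ l → All (_≤ l) left) (sym (length-⊖1 α))
                             (Allₚ.++⁺ (Allₚ.map⁺ (All.map (s≤s ∘ proj₂) (∈-↭-oneTo α-perm))) (s≤s z≤n ∷ [])))
                           (All.map proj₁ (∈-↭-oneTo β-perm))

      unique : Unique ((α ⊖1) ⊕ β)
      unique = Unique-↭-oneTo (⊖1⊕-↭ α-perm β-perm)

      left⊆ : left ⊆ (α ⊖1) ⊕ β
      left⊆ = Sublistₚ.++⁺ʳ right ⊆-refl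

      right⊆ : right ⊆ (α ⊖1) ⊕ β
      right⊆ = Sublistₚ.++⁺ˡ left ⊆-refl

      suc-α⊆ : map suc α ⊆ (α ⊖1) ⊕ β
      suc-α⊆ = ⊆-trans (Sublistₚ.++⁺ʳ [ 1 ] ⊆-refl) left⊆

    ⊖1⊕-Contains-312⁻ : Contains ((α ⊖1) ⊕ β) p312 → Contains α p312 ⊎ Contains β p312
    ⊖1⊕-Contains-312⁻ c with Contains-++-≪ 312-sumIndecomposable left≪right c
    ... | inj₂ c-right = inj₂ (Contains-map⁻ (+-orderInvariant (length left)) β c-right)
    ... | inj₁ c-left with Contains-∷ʳ-min 1<suc-α c-left
    ...   | inj₁ c-suc-α = inj₁ (Contains-map⁻ (+-orderInvariant 1) α c-suc-α)
    ...   | inj₂ (q , 312≡) with Listₚ.∷ʳ-injectiveʳ (3 ∷ 1 ∷ []) q 312≡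
    ...     | ()

    ⊖1⊕-Contains-312⁺ : Contains α p312 ⊎ Contains β p312 → Contains ((α ⊖1) ⊕ β) p312
    ⊖1⊕-Contains-312⁺ (inj₁ c) = Contains-⊆ suc-α⊆ (Contains-map⁺ (+-orderInvariant 1) c)
    ⊖1⊕-Contains-312⁺ (inj₂ c) = Contains-⊆ right⊆ (Contains-map⁺ (+-orderInvariant (length left)) c)

    ⊖1⊕-Contains-⊖1⁻ : ∀ {q} → Contains ((α ⊖1) ⊕ β) (q ⊖1) → Contains α q ⊎ Contains β (q ⊖1)
    ⊖1⊕-Contains-⊖1⁻ {q} c with Contains-++-≪ (∷ʳ1-sumIndecomposable (map suc q)) left≪right c
    ... | inj₁ c-left  = inj₁ (Contains-map⁻ (+-orderInvariant 1) α (Contains-⊖1⁻ (Unique-resp-⊇ left⊆ unique) c-left))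
    ... | inj₂ c-right = inj₂ (Contains-map⁻ (+-orderInvariant (length left)) β c-right)

    ⊖1⊕-Contains-⊖1⁺ : ∀ {q} → Contains α q ⊎ Contains β (q ⊖1) → Contains ((α ⊖1) ⊕ β) (q ⊖1)
    ⊖1⊕-Contains-⊖1⁺ (inj₁ c) = Contains-⊆ left⊆ (Contains-⊖1⁺ 1<suc-α (Contains-map⁺ (+-orderInvariant 1) c))
    ⊖1⊕-Contains-⊖1⁺ (inj₂ c) = Contains-⊆ right⊆ (Contains-map⁺ (+-orderInvariant (length left)) c)

    lis-⊖1⊕ : lis ((α ⊖1) ⊕ β) ≡ (lis α ⊔ 1) + lis β
    lis-⊖1⊕ = trans (lis-++-≪ left≪right)
                    (cong₂ _+_ (trans (lis-∷ʳ-min 1<suc-α) (cong (_⊔ 1) (lis-map (+-orderInvariant 1) α)))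
                               (lis-map (+-orderInvariant (length left)) β))

  ⊖1⊕-injective : ∀ {α α′ β β′} → All (0 <_) α → All (0 <_) α′ → (α ⊖1) ⊕ β ≡ (α′ ⊖1) ⊕ β′ → α ≡ α′ × β ≡ β′
  ⊖1⊕-injective {α} {α′} {β} {β′} 0<α 0<α′ eq with ++-∷-cancel (map suc α) (map suc α′) (1∉ 0<α) (1∉ 0<α′)
                                                     (trans (sym (⊖1⊕≡ α β)) (trans eq (⊖1⊕≡ α′ β′)))
    where
    1∉ : ∀ {γ} → All (0 <_) γ → 1 ∉ map suc γ
    1∉ 0<γ 1∈ with ∈-map⁻ suc 1∈
    ... | _ , x∈ , refl = ℕₚ.<-irrefl refl (All.lookup 0<γ x∈)
  ... | sucα≡ , rest≡ with Listₚ.map-injective ℕₚ.suc-injective sucα≡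
  ...   | refl = refl , Listₚ.map-injective (ℕₚ.+-cancelˡ-≡ (suc (length α)) _ _) rest≡

  avoiding : List ℕ → List ℕ → Bool
  avoiding τ σ = avoids σ p312 ∧ avoids σ τ

  Av : List ℕ → ℕ → List (List ℕ)
  Av τ n = filterᵇ (avoiding τ) (S n)

  coef≡count : ∀ τ n m → coef τ n m ≡ count (λ σ → lis σ ≡ᵇ m) (Av τ n)
  coef≡count τ n m = begin
    coef τ n m                                                  ≡⟨ length-filterᵇ _ (S n) ⟩
    count (λ σ → avoids σ p312 ∧ avoids σ τ ∧ (lis σ ≡ᵇ m)) (S n) ≡⟨ count-cong (S n) (λ {σ} _ → sym (∧-assoc (avoids σ p312) _ _)) ⟩
    count (λ σ → avoiding τ σ ∧ (lis σ ≡ᵇ m)) (S n)              ≡⟨ count-filterᵇ _ (avoiding τ) (S n) ⟨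
    count (λ σ → lis σ ≡ᵇ m) (Av τ n)                           ∎
    where open ≡-Reasoning

  ∈-Av⁻ : ∀ {τ n σ} → σ ∈ Av τ n → σ ↭ oneTo n × ¬ Contains σ p312 × ¬ Contains σ τ
  ∈-Av⁻ {τ} {n} σ∈ with ∈-filter⁻ (T? ∘ avoiding τ) σ∈
  ... | σ∈S , avoid with Equivalence.to T-∧ avoid
  ...   | avoid-312 , avoid-τ = S-sound n σ∈S , avoids⇒¬Contains avoid-312 , avoids⇒¬Contains avoid-τ

  ∈-Av⁺ : ∀ {τ n σ} → σ ↭ oneTo n → ¬ Contains σ p312 → ¬ Contains σ τ → σ ∈ Av τ n
  ∈-Av⁺ {τ} {n} σ↭ ¬312 ¬τ =
    ∈-filter⁺ (T? ∘ avoiding τ) (S-complete n σ↭) (Equivalence.from T-∧ (¬Contains⇒avoids ¬312 , ¬Contains⇒avoids ¬τ))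

  Unique-Av : ∀ τ n → Unique (Av τ n)
  Unique-Av τ n = Uniqueₚ.filter⁺ (T? ∘ avoiding τ) (Unique-S n)

  ↭oneTo⇒IsPermutation : ∀ {n σ} → σ ↭ oneTo n → IsPermutation σ
  ↭oneTo⇒IsPermutation {σ = σ} σ↭ = subst (λ l → σ ↭ oneTo l) (sym (length-↭-oneTo σ↭)) σ↭

  ⊖1⊕-block : List ℕ → ℕ → ℕ → List (List ℕ)
  ⊖1⊕-block q n a = concatMap (λ α → map ((α ⊖1) ⊕_) (Av (q ⊖1) (n ∸ a))) (Av q a)

  ⊖1⊕-blocks : List ℕ → ℕ → List (List ℕ)
  ⊖1⊕-blocks q n = concatMap (⊖1⊕-block q n) (upTo (suc n))

  private
    Av-positive : ∀ {τ n α} → α ∈ Av τ n → All (0 <_) α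
    Av-positive {τ} {n} α∈ = All.map proj₁ (∈-↭-oneTo (proj₁ (∈-Av⁻ {τ} {n} α∈)))

  ∈-⊖1⊕-block⁻ : ∀ {q n a σ} → σ ∈ ⊖1⊕-block q n a →
                 ∃₂ λ α β → α ∈ Av q a × β ∈ Av (q ⊖1) (n ∸ a) × σ ≡ (α ⊖1) ⊕ β
  ∈-⊖1⊕-block⁻ {q} {n} {a} σ∈ with find (∈-concatMap⁻ _ {Av q a} σ∈)
  ... | α , α∈ , σ∈′ with ∈-map⁻ ((α ⊖1) ⊕_) σ∈′
  ...   | β , β∈ , refl = α , β , α∈ , β∈ , refl

  Unique-⊖1⊕-block : ∀ q n a → Unique (⊖1⊕-block q n a)
  Unique-⊖1⊕-block q n a = Unique-concatMap _ (Unique-Av q a)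
    (All.tabulate (λ α∈ → Uniqueₚ.map⁺ (λ eq → proj₂ (⊖1⊕-injective (Av-positive {q} {a} α∈) (Av-positive {q} {a} α∈) eq)) (Unique-Av (q ⊖1) (n ∸ a))))
    same-α
    where
    same-α : ∀ {α α′ σ} → α ∈ Av q a → α′ ∈ Av q a → σ ∈ map ((α ⊖1) ⊕_) (Av (q ⊖1) (n ∸ a)) →
             σ ∈ map ((α′ ⊖1) ⊕_) (Av (q ⊖1) (n ∸ a)) → α ≡ α′
    same-α {α} {α′} α∈ α′∈ σ∈ σ∈′ with ∈-map⁻ ((α ⊖1) ⊕_) σ∈ | ∈-map⁻ ((α′ ⊖1) ⊕_) σ∈′
    ... | _ , _ , σ≡ | _ , _ , σ≡′ = proj₁ (⊖1⊕-injective (Av-positive {q} {a} α∈) (Av-positive {q} {a} α′∈) (trans (sym σ≡) σ≡′))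

  Unique-⊖1⊕-blocks : ∀ q n → Unique (⊖1⊕-blocks q n)
  Unique-⊖1⊕-blocks q n = Unique-concatMap (⊖1⊕-block q n) (Uniqueₚ.upTo⁺ (suc n))
    (All.tabulate (λ {a} _ → Unique-⊖1⊕-block q n a)) same-a
    where
    same-a : ∀ {a a′ σ} → a ∈ upTo (suc n) → a′ ∈ upTo (suc n) → σ ∈ ⊖1⊕-block q n a → σ ∈ ⊖1⊕-block q n a′ → a ≡ a′
    same-a {a} {a′} _ _ σ∈ σ∈′ with ∈-⊖1⊕-block⁻ {q} {n} {a} σ∈ | ∈-⊖1⊕-block⁻ {q} {n} {a′} σ∈′
    ... | α , _ , α∈ , _ , σ≡ | α′ , _ , α′∈ , _ , σ≡′
      with ⊖1⊕-injective (Av-positive {q} {a} α∈) (Av-positive {q} {a′} α′∈) (trans (sym σ≡) σ≡′)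
    ...   | refl , _ = trans (sym (length-↭-oneTo (proj₁ (∈-Av⁻ {q} {a} α∈)))) (length-↭-oneTo (proj₁ (∈-Av⁻ {q} {a′} α′∈)))

  Av-⊖1-suc↭ : ∀ q n → Av (q ⊖1) (suc n) ↭ ⊖1⊕-blocks q n
  Av-⊖1-suc↭ q n = unique-↭ (Unique-Av (q ⊖1) (suc n)) (Unique-⊖1⊕-blocks q n) to from
    where
    to : ∀ {σ} → σ ∈ Av (q ⊖1) (suc n) → σ ∈ ⊖1⊕-blocks q n
    to σ∈ with ∈-Av⁻ {q ⊖1} {suc n} σ∈
    ... | σ↭ , ¬312 , ¬τ with decompose n σ↭ ¬312
    ...   | α , β , α-perm , β-perm , |α|+|β|≡n , refl =
      ∈-concatMap⁺ _ (lose (∈-upTo⁺ (s≤s (subst (length α ≤_) |α|+|β|≡n (ℕₚ.m≤m+n _ _))))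
                     (∈-concatMap⁺ _ (lose α∈ (∈-map⁺ _ β∈))))
      where
      α∈ : α ∈ Av q (length α)
      α∈ = ∈-Av⁺ α-perm (¬312 ∘ ⊖1⊕-Contains-312⁺ α-perm β-perm ∘ inj₁) (¬τ ∘ ⊖1⊕-Contains-⊖1⁺ α-perm β-perm ∘ inj₁)
      |β|≡ : length β ≡ n ∸ length α
      |β|≡ = trans (sym (ℕₚ.m+n∸m≡n (length α) (length β))) (cong (_∸ length α) |α|+|β|≡n)
      β∈ : β ∈ Av (q ⊖1) (n ∸ length α)
      β∈ = ∈-Av⁺ (subst (λ l → β ↭ oneTo l) |β|≡ β-perm)
                 (¬312 ∘ ⊖1⊕-Contains-312⁺ α-perm β-perm ∘ inj₂) (¬τ ∘ ⊖1⊕-Contains-⊖1⁺ α-perm β-perm ∘ inj₂)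
    from : ∀ {σ} → σ ∈ ⊖1⊕-blocks q n → σ ∈ Av (q ⊖1) (suc n)
    from σ∈ with find (∈-concatMap⁻ _ σ∈)
    ... | a , a∈ , σ∈′ with ∈-upTo⁻ a∈ | ∈-⊖1⊕-block⁻ {q} {n} {a} σ∈′
    ...   | s≤s a≤n | α , β , α∈ , β∈ , refl with ∈-Av⁻ {q} {a} α∈ | ∈-Av⁻ {q ⊖1} {n ∸ a} β∈
    ...     | α↭ , ¬312-α , ¬q-α | β↭ , ¬312-β , ¬τ-β =
      ∈-Av⁺ (subst (λ l → (α ⊖1) ⊕ β ↭ oneTo (suc l)) (ℕₚ.m+[n∸m]≡n a≤n) (⊖1⊕-↭ α↭ β↭))
            (Sum.[ ¬312-α , ¬312-β ] ∘ ⊖1⊕-Contains-312⁻ α-perm β-perm)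
            (Sum.[ ¬q-α , ¬τ-β ] ∘ ⊖1⊕-Contains-⊖1⁻ α-perm β-perm)
      where
      α-perm = ↭oneTo⇒IsPermutation α↭
      β-perm = ↭oneTo⇒IsPermutation β↭

  sum-map-+ : ∀ {A : Set} (f g : A → ℕ) xs → sum (map (λ x → f x + g x) xs) ≡ sum (map f xs) + sum (map g xs)
  sum-map-+ f g []       = refl
  sum-map-+ f g (x ∷ xs) = trans (cong (f x + g x +_) (sum-map-+ f g xs)) (ℕ-interchange (f x) (g x) _ _)

  sum-map-cong : ∀ {A : Set} {f g : A → ℕ} xs → (∀ {x} → x ∈ xs → f x ≡ g x) → sum (map f xs) ≡ sum (map g xs)
  sum-map-cong xs f≗g = cong sum (Listₚ.map-cong-local (All.tabulate f≗g))

  sum-map-0 : ∀ {A : Set} (xs : List A) → sum (map (λ _ → 0) xs) ≡ 0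
  sum-map-0 []       = refl
  sum-map-0 (x ∷ xs) = sum-map-0 xs

  indicator : ℕ → (ℕ → ℕ) → ℕ → ℕ
  indicator k g j = if k ≡ᵇ j then g j else 0

  sum-indicator-∉ : ∀ {k} g js → k ∉ js → sum (map (indicator k g) js) ≡ 0
  sum-indicator-∉     g []       _  = refl
  sum-indicator-∉ {k} g (j ∷ js) k∉ rewrite ¬T⇒≡false (k∉ ∘ here ∘ ℕₚ.≡ᵇ⇒≡ k j) = sum-indicator-∉ g js (k∉ ∘ there)

  sum-indicator-∈ : ∀ {k} g js → Unique js → k ∈ js → sum (map (indicator k g) js) ≡ g k
  sum-indicator-∈ {k} g (j ∷ js) (j∉ ∷ _) (here refl)
    rewrite T⇒≡true (ℕₚ.≡⇒≡ᵇ k k refl) = trans (cong (g k +_) (sum-indicator-∉ g js (λ k∈ → All.lookup j∉ k∈ refl))) (ℕₚ.+-identityʳ _)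
  sum-indicator-∈ {k} g (j ∷ js) (j∉ ∷ ujs) (there k∈)
    rewrite ¬T⇒≡false (All.lookup j∉ k∈ ∘ sym ∘ ℕₚ.≡ᵇ⇒≡ k j) = sum-indicator-∈ g js ujs k∈

  sum-by-key : ∀ {A : Set} (k : A → ℕ) (g : ℕ → ℕ) js → Unique js → ∀ xs →
               (∀ {x} → x ∈ xs → k x ∉ js → g (k x) ≡ 0) →
               sum (map (g ∘ k) xs) ≡ sum (map (λ j → count (λ x → k x ≡ᵇ j) xs * g j) js)
  sum-by-key k g js unique []       _       = sym (sum-map-0 js)
  sum-by-key k g js unique (x ∷ xs) outside = begin
    g (k x) + sum (map (g ∘ k) xs)
      ≡⟨ cong₂ _+_ (sym first) (sum-by-key k g js unique xs (outside ∘ there)) ⟩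
    sum (map (indicator (k x) g) js) + sum (map (λ j → count (λ y → k y ≡ᵇ j) xs * g j) js)
      ≡⟨ sum-map-+ _ _ js ⟨
    sum (map (λ j → indicator (k x) g j + count (λ y → k y ≡ᵇ j) xs * g j) js)
      ≡⟨ sum-map-cong js (λ {j} _ → split j) ⟩
    sum (map (λ j → count (λ y → k y ≡ᵇ j) (x ∷ xs) * g j) js) ∎
    where
    open ≡-Reasoning
    first : sum (map (indicator (k x) g) js) ≡ g (k x)
    first with k x ∈? js
    ... | yes k∈ = sum-indicator-∈ g js unique k∈
    ... | no  k∉ = trans (sum-indicator-∉ g js k∉) (sym (outside (here refl) k∉))
    split : ∀ j → indicator (k x) g j + count (λ y → k y ≡ᵇ j) xs * g j ≡ count (λ y → k y ≡ᵇ j) (x ∷ xs) * g j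
    split j with k x ≡ᵇ j
    ... | true  = refl
    ... | false = refl

  +-≡ᵇ-cancelˡ : ∀ c l d → (c + l ≡ᵇ c + d) ≡ (l ≡ᵇ d)
  +-≡ᵇ-cancelˡ zero    l d = refl
  +-≡ᵇ-cancelˡ (suc c) l d = +-≡ᵇ-cancelˡ c l d

  module _ {A : Set} (f : A → ℕ) where

    count-+≡ᵇ-≤ : ∀ {c m} → c ≤ m → ∀ xs → count (λ x → c + f x ≡ᵇ m) xs ≡ count (λ x → f x ≡ᵇ m ∸ c) xs
    count-+≡ᵇ-≤ {c} {m} c≤m xs = count-cong xs λ {x} _ →
      trans (cong (λ n → c + f x ≡ᵇ n) (sym (ℕₚ.m+[n∸m]≡n c≤m))) (+-≡ᵇ-cancelˡ c (f x) (m ∸ c))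

    count-+≡ᵇ-> : ∀ {c m} → m < c → ∀ xs → count (λ x → c + f x ≡ᵇ m) xs ≡ 0
    count-+≡ᵇ-> {c} {m} m<c xs = count-none _ {xs} (All.tabulate λ {x} _ →
      ¬T⇒≡false (λ t → ℕₚ.<-irrefl refl (ℕₚ.<-≤-trans m<c (subst (c ≤_) (ℕₚ.≡ᵇ⇒≡ _ _ t) (ℕₚ.m≤m+n c (f x))))))

  lisWeight : List ℕ → ℕ → ℕ → ℕ
  lisWeight q a j = count (λ α → lis α ⊔ 1 ≡ᵇ j) (Av q a)

  count-⊖1⊕-block : ∀ q n m a → count (λ σ → lis σ ≡ᵇ m) (⊖1⊕-block q n a) ≡
                    sum (map (λ j → lisWeight q a j * coef (q ⊖1) (n ∸ a) (m ∸ j)) (upTo (suc m)))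
  count-⊖1⊕-block q n m a = begin
    count (λ σ → lis σ ≡ᵇ m) (⊖1⊕-block q n a)
      ≡⟨ count-concatMap _ _ (Av q a) ⟩
    sum (map (λ α → count (λ σ → lis σ ≡ᵇ m) (map ((α ⊖1) ⊕_) B)) (Av q a))
      ≡⟨ sum-map-cong (Av q a) (λ α∈ → trans (count-map _ _ B) (count-cong B (λ β∈ → cong (_≡ᵇ m) (lis-glue α∈ β∈)))) ⟩
    sum (map (g ∘ (λ α → lis α ⊔ 1)) (Av q a))
      ≡⟨ sum-by-key (λ α → lis α ⊔ 1) g (upTo (suc m)) (Uniqueₚ.upTo⁺ (suc m)) (Av q a)
                    (λ {α} _ k∉ → count-+≡ᵇ-> lis (ℕₚ.≰⇒> (k∉ ∘ ∈-upTo⁺ ∘ s≤s)) B) ⟩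
    sum (map (λ j → lisWeight q a j * g j) (upTo (suc m)))
      ≡⟨ sum-map-cong (upTo (suc m)) (λ j∈ → cong (lisWeight q a _ *_)
           (trans (count-+≡ᵇ-≤ lis (ℕₚ.≤-pred (∈-upTo⁻ j∈)) B) (sym (coef≡count (q ⊖1) (n ∸ a) _)))) ⟩
    sum (map (λ j → lisWeight q a j * coef (q ⊖1) (n ∸ a) (m ∸ j)) (upTo (suc m))) ∎
    where
    open ≡-Reasoning
    B = Av (q ⊖1) (n ∸ a)
    g : ℕ → ℕ
    g c = count (λ β → c + lis β ≡ᵇ m) B
    lis-glue : ∀ {α β} → α ∈ Av q a → β ∈ B → lis ((α ⊖1) ⊕ β) ≡ (lis α ⊔ 1) + lis β
    lis-glue α∈ β∈ = lis-⊖1⊕ (↭oneTo⇒IsPermutation (proj₁ (∈-Av⁻ {q} {a} α∈)))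
                             (↭oneTo⇒IsPermutation (proj₁ (∈-Av⁻ {q ⊖1} {n ∸ a} β∈)))

  coef-⊖1-suc : ∀ q n m → coef (q ⊖1) (suc n) m ≡
    sum (map (λ a → sum (map (λ j → lisWeight q a j * coef (q ⊖1) (n ∸ a) (m ∸ j)) (upTo (suc m)))) (upTo (suc n)))
  coef-⊖1-suc q n m = begin
    coef (q ⊖1) (suc n) m                                        ≡⟨ coef≡count (q ⊖1) (suc n) m ⟩
    count (λ σ → lis σ ≡ᵇ m) (Av (q ⊖1) (suc n))                ≡⟨ count-↭ _ (Av-⊖1-suc↭ q n) ⟩
    count (λ σ → lis σ ≡ᵇ m) (⊖1⊕-blocks q n)                   ≡⟨ count-concatMap _ (⊖1⊕-block q n) (upTo (suc n)) ⟩
    sum (map (count (λ σ → lis σ ≡ᵇ m) ∘ ⊖1⊕-block q n) (upTo (suc n)))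
      ≡⟨ sum-map-cong (upTo (suc n)) (λ {a} _ → count-⊖1⊕-block q n m a) ⟩
    sum (map (λ a → sum (map (λ j → lisWeight q a j * coef (q ⊖1) (n ∸ a) (m ∸ j)) (upTo (suc m)))) (upTo (suc n))) ∎
    where open ≡-Reasoning

  ¬Contains-[] : ∀ {p} → p ≢ [] → ¬ Contains [] p
  ¬Contains-[] p≢[] (.[] , [] , red[]≡p) = p≢[] (sym red[]≡p)

  Av-0 : ∀ {τ} → τ ≢ [] → Av τ 0 ≡ [] ∷ []
  Av-0 {τ} τ≢[] with avoiding τ [] | avoiding-[]
    where
    avoiding-[] : avoiding τ [] ≡ true
    avoiding-[] = T⇒≡true (Equivalence.from T-∧ (¬Contains⇒avoids {[]} {p312} (¬Contains-[] (λ ())) , ¬Contains⇒avoids {[]} {τ} (¬Contains-[] τ≢[])))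
  ... | true | refl = refl

  lisWeight-suc : ∀ q a j → lisWeight q (suc a) j ≡ coef q (suc a) j
  lisWeight-suc q a j = trans (count-cong (Av q (suc a)) (λ α∈ → cong (_≡ᵇ j) (ℕₚ.m≥n⇒m⊔n≡m (lis-positive α∈))))
                              (sym (coef≡count q (suc a) j))
    where
    lis-positive : ∀ {α} → α ∈ Av q (suc a) → 1 ≤ lis α
    lis-positive {α} α∈ with α | length-↭-oneTo (proj₁ (∈-Av⁻ {q} {suc a} α∈))
    ... | x ∷ α′ | _ = lis-upper {x ∷ []} (refl ∷ minimum α′) _

open Combinatorics

module Series where

  open import Data.Integer using (+_; _+_; _*_; _-_; -_)
  open import Algebra.Properties.CommutativeSemigroup ℤₚ.+-commutativeSemigroup using () renaming (interchange to ℤ-interchange)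

  sumTo-cong : ∀ n {f g : ℕ → ℤ} → (∀ i → i ≤ n → f i ≡ g i) → sumTo n f ≡ sumTo n g
  sumTo-cong zero    f≗g = f≗g 0 z≤n
  sumTo-cong (suc n) f≗g = cong₂ _+_ (sumTo-cong n (λ i i≤n → f≗g i (ℕₚ.m≤n⇒m≤1+n i≤n))) (f≗g (suc n) ℕₚ.≤-refl)

  sumTo-+ : ∀ n (f g : ℕ → ℤ) → sumTo n (λ i → f i + g i) ≡ sumTo n f + sumTo n g
  sumTo-+ zero    f g = refl
  sumTo-+ (suc n) f g = trans (cong (_+ (f (suc n) + g (suc n))) (sumTo-+ n f g)) (ℤ-interchange (sumTo n f) _ _ _)

  sumTo-neg : ∀ n (f : ℕ → ℤ) → sumTo n (λ i → - f i) ≡ - sumTo n f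
  sumTo-neg zero    f = refl
  sumTo-neg (suc n) f = trans (cong (_+ - f (suc n)) (sumTo-neg n f)) (sym (ℤₚ.neg-distrib-+ (sumTo n f) (f (suc n))))

  sumTo-sub : ∀ n (f g : ℕ → ℤ) → sumTo n (λ i → f i - g i) ≡ sumTo n f - sumTo n g
  sumTo-sub n f g = trans (sumTo-+ n f (λ i → - g i)) (cong (ℤ._+_ (sumTo n f)) (sumTo-neg n g))

  sumTo-*ˡ : ∀ n c (f : ℕ → ℤ) → sumTo n (λ i → c * f i) ≡ c * sumTo n f
  sumTo-*ˡ zero    c f = refl
  sumTo-*ˡ (suc n) c f = trans (cong (_+ c * f (suc n)) (sumTo-*ˡ n c f)) (sym (ℤₚ.*-distribˡ-+ c (sumTo n f) (f (suc n))))

  sumTo-*ʳ : ∀ n c (f : ℕ → ℤ) → sumTo n (λ i → f i * c) ≡ sumTo n f * c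
  sumTo-*ʳ zero    c f = refl
  sumTo-*ʳ (suc n) c f = trans (cong (_+ f (suc n) * c) (sumTo-*ʳ n c f)) (sym (ℤₚ.*-distribʳ-+ c (sumTo n f) (f (suc n))))

  sumTo-zero : ∀ n {f : ℕ → ℤ} → (∀ i → i ≤ n → f i ≡ + 0) → sumTo n f ≡ + 0
  sumTo-zero n f≡0 = trans (sumTo-cong n f≡0) (zeros n)
    where
    zeros : ∀ n → sumTo n (λ _ → + 0) ≡ + 0
    zeros zero    = refl
    zeros (suc n) = cong (_+ + 0) (zeros n)

  sumTo-extend : ∀ {b} k (f : ℕ → ℤ) → b ≤ k → (∀ i → b < i → f i ≡ + 0) → sumTo k f ≡ sumTo b f
  sumTo-extend k f b≤k f≡0 with ℕₚ.m≤n⇒m<n∨m≡n b≤k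
  ... | inj₂ refl = refl
  sumTo-extend (suc k) f _ f≡0 | inj₁ (s≤s b≤k) =
    trans (cong (ℤ._+_ (sumTo k f)) (f≡0 (suc k) (s≤s b≤k))) (trans (ℤₚ.+-identityʳ _) (sumTo-extend k f b≤k f≡0))

  sumTo-suc : ∀ n (f : ℕ → ℤ) → sumTo (suc n) f ≡ f 0 + sumTo n (f ∘ suc)
  sumTo-suc zero    f = refl
  sumTo-suc (suc n) f = trans (cong (_+ f (suc (suc n))) (sumTo-suc n f)) (ℤₚ.+-assoc (f 0) _ _)

  sumTo-reverse : ∀ n (f : ℕ → ℤ) → sumTo n f ≡ sumTo n (λ i → f (n ∸ i))
  sumTo-reverse zero    f = refl
  sumTo-reverse (suc n) f = trans (cong (_+ f (suc n)) (sumTo-reverse n f))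
    (trans (ℤₚ.+-comm _ (f (suc n))) (sym (sumTo-suc n (λ i → f (suc n ∸ i)))))

  sumTo-swap : ∀ n m (t : ℕ → ℕ → ℤ) → sumTo n (λ i → sumTo m (t i)) ≡ sumTo m (λ j → sumTo n (λ i → t i j))
  sumTo-swap zero    m t = refl
  sumTo-swap (suc n) m t = trans (cong (_+ sumTo m (t (suc n))) (sumTo-swap n m t)) (sym (sumTo-+ m (λ j → sumTo n (λ i → t i j)) (t (suc n))))

  sumTo-triangle : ∀ N (t : ℕ → ℕ → ℤ) →
                   sumTo N (λ m → sumTo m (λ j → t j m)) ≡ sumTo N (λ j → sumTo (N ∸ j) (λ l → t j (j ℕ.+ l)))
  sumTo-triangle zero    t = refl
  sumTo-triangle (suc N) t = begin
    sumTo N (λ m → sumTo m (λ j → t j m)) + (sumTo N (λ j → t j (suc N)) + t (suc N) (suc N))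
      ≡⟨ cong (_+ (sumTo N (λ j → t j (suc N)) + t (suc N) (suc N))) (sumTo-triangle N t) ⟩
    R + (sumTo N (λ j → t j (suc N)) + t (suc N) (suc N))
      ≡⟨ ℤₚ.+-assoc R _ _ ⟨
    (R + sumTo N (λ j → t j (suc N))) + t (suc N) (suc N)
      ≡⟨ cong₂ _+_ (trans (sym (sumTo-+ N _ _)) (sumTo-cong N step)) (cong (t (suc N)) (sym (ℕₚ.+-identityʳ (suc N)))) ⟩
    sumTo N (λ j → sumTo (suc N ∸ j) (λ l → t j (j ℕ.+ l))) + t (suc N) (suc N ℕ.+ 0)
      ≡⟨ cong (λ k → sumTo N (λ j → sumTo (suc N ∸ j) (λ l → t j (j ℕ.+ l))) + sumTo k (λ l → t (suc N) (suc N ℕ.+ l)))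
              (sym (ℕₚ.n∸n≡0 N)) ⟩
    sumTo (suc N) (λ j → sumTo (suc N ∸ j) (λ l → t j (j ℕ.+ l))) ∎
    where
    open ≡-Reasoning
    R = sumTo N (λ j → sumTo (N ∸ j) (λ l → t j (j ℕ.+ l)))
    step : ∀ j → j ≤ N → sumTo (N ∸ j) (λ l → t j (j ℕ.+ l)) + t j (suc N) ≡ sumTo (suc N ∸ j) (λ l → t j (j ℕ.+ l))
    step j j≤N rewrite ℕₚ.+-∸-assoc 1 j≤N = cong (λ k → sumTo (N ∸ j) (λ l → t j (j ℕ.+ l)) + t j k)
      (sym (trans (ℕₚ.+-suc j (N ∸ j)) (cong suc (ℕₚ.m+[n∸m]≡n j≤N))))

  sumTo-δ : ∀ n (f : ℕ → ℤ) → sumTo n (λ i → f i * δ (n ∸ i)) ≡ f n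
  sumTo-δ zero    f = ℤₚ.*-identityʳ (f 0)
  sumTo-δ (suc n) f = trans (cong₂ _+_ (sumTo-zero n earlier) last) (ℤₚ.+-identityˡ _)
    where
    earlier : ∀ i → i ≤ n → f i * δ (suc n ∸ i) ≡ + 0
    earlier i i≤n = trans (cong (λ k → f i * δ k) (ℕₚ.+-∸-assoc 1 i≤n)) (ℤₚ.*-zeroʳ (f i))
    last : f (suc n) * δ (n ∸ n) ≡ f (suc n)
    last = trans (cong (λ k → f (suc n) * δ k) (ℕₚ.n∸n≡0 n)) (ℤₚ.*-identityʳ (f (suc n)))

  VanishesAbove : ℕ → (ℕ → ℤ) → Set
  VanishesAbove a A = ∀ j → a < j → A j ≡ + 0

  sumTo-convolution : ∀ a b (A B : ℕ → ℤ) → VanishesAbove a A → VanishesAbove b B →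
                      sumTo (a ℕ.+ b) (λ m → sumTo m (λ j → A j * B (m ∸ j))) ≡ sumTo a A * sumTo b B
  sumTo-convolution a b A B A≡0 B≡0 = begin
    sumTo N (λ m → sumTo m (λ j → A j * B (m ∸ j)))
      ≡⟨ sumTo-triangle N (λ j m → A j * B (m ∸ j)) ⟩
    sumTo N (λ j → sumTo (N ∸ j) (λ l → A j * B ((j ℕ.+ l) ∸ j)))
      ≡⟨ sumTo-cong N (λ j _ → trans (sumTo-cong (N ∸ j) (λ l _ → cong (λ k → A j * B k) (ℕₚ.m+n∸m≡n j l)))
                                     (sumTo-*ˡ (N ∸ j) (A j) B)) ⟩
    sumTo N (λ j → A j * sumTo (N ∸ j) B)
      ≡⟨ sumTo-cong N (λ j _ → truncate j) ⟩
    sumTo N (λ j → A j * sumTo b B)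
      ≡⟨ sumTo-*ʳ N (sumTo b B) A ⟩
    sumTo N A * sumTo b B
      ≡⟨ cong (_* sumTo b B) (sumTo-extend N A (ℕₚ.m≤m+n a b) A≡0) ⟩
    sumTo a A * sumTo b B ∎
    where
    open ≡-Reasoning
    N = a ℕ.+ b
    truncate : ∀ j → A j * sumTo (N ∸ j) B ≡ A j * sumTo b B
    truncate j with ℕₚ.≤-<-connex j a
    ... | inj₁ j≤a = cong (A j *_) (sumTo-extend (N ∸ j) B (subst (b ≤_) (sym (ℕₚ.+-∸-comm b j≤a)) (ℕₚ.m≤n+m b (a ∸ j))) B≡0)
    ... | inj₂ a<j rewrite A≡0 j a<j = refl

  DegreeBounded : FPS₂ → Set
  DegreeBounded u = ∀ n → VanishesAbove n (u n)

  -- atQ1 and dQatQ1 only look at the q-coefficients up to degree n, so they respect products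
  -- only of series whose x^n-coefficient is a polynomial in q of degree at most n.
  atQ1-*₂ : ∀ u v → DegreeBounded u → DegreeBounded v → atQ1 (u *₂ v) ≗ atQ1 u *₁ atQ1 v
  atQ1-*₂ u v u-deg v-deg n = begin
    sumTo n (λ m → sumTo n (λ i → sumTo m (λ j → u i j * v (n ∸ i) (m ∸ j))))
      ≡⟨ sumTo-swap n n (λ m i → sumTo m (λ j → u i j * v (n ∸ i) (m ∸ j))) ⟩
    sumTo n (λ i → sumTo n (λ m → sumTo m (λ j → u i j * v (n ∸ i) (m ∸ j))))
      ≡⟨ sumTo-cong n (λ i i≤n → trans (cong (λ N → sumTo N (λ m → sumTo m (λ j → u i j * v (n ∸ i) (m ∸ j))))
                                              (sym (ℕₚ.m+[n∸m]≡n i≤n)))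
                                       (sumTo-convolution i (n ∸ i) (u i) (v (n ∸ i)) (u-deg i) (v-deg (n ∸ i)))) ⟩
    sumTo n (λ i → atQ1 u i * atQ1 v (n ∸ i)) ∎
    where open ≡-Reasoning

  weighted : (ℕ → ℤ) → ℕ → ℤ
  weighted A j = + j * A j

  VanishesAbove-weighted : ∀ {a A} → VanishesAbove a A → VanishesAbove a (weighted A)
  VanishesAbove-weighted A≡0 j a<j rewrite A≡0 j a<j = ℤₚ.*-zeroʳ (+ j)

  -- m = j + (m - j) splits the weight of a product term between its two factors.
  weight-split : ∀ (m j : ℕ) (x y : ℤ) → j ≤ m → + m * (x * y) ≡ (+ j * x) * y + x * (+ (m ∸ j) * y)
  weight-split m j x y j≤m =
    trans (cong (λ z → z * (x * y)) (trans (cong +_ (sym (ℕₚ.m+[n∸m]≡n j≤m))) (ℤₚ.pos-+ j (m ∸ j))))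
          (distribute (+ j) (+ (m ∸ j)) x y)
    where
    distribute : ∀ (p q x y : ℤ) → (p + q) * (x * y) ≡ (p * x) * y + x * (q * y)
    distribute = solve-∀

  dQatQ1-*₂ : ∀ u v → DegreeBounded u → DegreeBounded v →
              dQatQ1 (u *₂ v) ≗ (dQatQ1 u *₁ atQ1 v) +₁ (atQ1 u *₁ dQatQ1 v)
  dQatQ1-*₂ u v u-deg v-deg n = begin
    sumTo n (λ m → + m * sumTo n (λ i → sumTo m (λ j → u i j * v (n ∸ i) (m ∸ j))))
      ≡⟨ sumTo-cong n (λ m _ → trans (sym (sumTo-*ˡ n (+ m) _)) (sumTo-cong n (λ i _ → sym (sumTo-*ˡ m (+ m) _)))) ⟩
    sumTo n (λ m → sumTo n (λ i → sumTo m (λ j → + m * (u i j * v (n ∸ i) (m ∸ j)))))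
      ≡⟨ sumTo-swap n n _ ⟩
    sumTo n (λ i → sumTo n (λ m → sumTo m (λ j → + m * (u i j * v (n ∸ i) (m ∸ j)))))
      ≡⟨ sumTo-cong n term ⟩
    sumTo n (λ i → dQatQ1 u i * atQ1 v (n ∸ i) + atQ1 u i * dQatQ1 v (n ∸ i))
      ≡⟨ sumTo-+ n _ _ ⟩
    ((dQatQ1 u *₁ atQ1 v) +₁ (atQ1 u *₁ dQatQ1 v)) n ∎
    where
    open ≡-Reasoning
    convolve : ∀ i → i ≤ n → ∀ {A B : ℕ → ℤ} → VanishesAbove i A → VanishesAbove (n ∸ i) B →
               sumTo n (λ m → sumTo m (λ j → A j * B (m ∸ j))) ≡ sumTo i A * sumTo (n ∸ i) B
    convolve i i≤n {A} {B} A≡0 B≡0 = trans (cong (λ N → sumTo N (λ m → sumTo m (λ j → A j * B (m ∸ j)))) (sym (ℕₚ.m+[n∸m]≡n i≤n)))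
                                           (sumTo-convolution i (n ∸ i) A B A≡0 B≡0)
    term : ∀ i → i ≤ n → sumTo n (λ m → sumTo m (λ j → + m * (u i j * v (n ∸ i) (m ∸ j)))) ≡
                         dQatQ1 u i * atQ1 v (n ∸ i) + atQ1 u i * dQatQ1 v (n ∸ i)
    term i i≤n = begin
      sumTo n (λ m → sumTo m (λ j → + m * (u i j * v (n ∸ i) (m ∸ j))))
        ≡⟨ sumTo-cong n (λ m _ → trans (sumTo-cong m (λ j j≤m → weight-split m j (u i j) (v (n ∸ i) (m ∸ j)) j≤m)) (sumTo-+ m _ _)) ⟩
      sumTo n (λ m → sumTo m (λ j → weighted (u i) j * v (n ∸ i) (m ∸ j)) + sumTo m (λ j → u i j * weighted (v (n ∸ i)) (m ∸ j)))
        ≡⟨ sumTo-+ n _ _ ⟩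
      sumTo n (λ m → sumTo m (λ j → weighted (u i) j * v (n ∸ i) (m ∸ j))) + sumTo n (λ m → sumTo m (λ j → u i j * weighted (v (n ∸ i)) (m ∸ j)))
        ≡⟨ cong₂ _+_ (convolve i i≤n (VanishesAbove-weighted (u-deg i)) (v-deg (n ∸ i)))
                     (convolve i i≤n (u-deg i) (VanishesAbove-weighted (v-deg (n ∸ i)))) ⟩
      dQatQ1 u i * atQ1 v (n ∸ i) + atQ1 u i * dQatQ1 v (n ∸ i) ∎

  DegreeBounded-*₂ : ∀ {u v} → DegreeBounded u → DegreeBounded v → DegreeBounded (u *₂ v)
  DegreeBounded-*₂ {u} {v} u-deg v-deg n m n<m = sumTo-zero n (λ i i≤n → sumTo-zero m (λ j _ → term i j i≤n))
    where
    term : ∀ i j → i ≤ n → u i j * v (n ∸ i) (m ∸ j) ≡ + 0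
    term i j i≤n with ℕₚ.≤-<-connex j i
    ... | inj₁ j≤i rewrite v-deg (n ∸ i) (m ∸ j) (ℕₚ.≤-<-trans (ℕₚ.∸-monoʳ-≤ n j≤i) (ℕₚ.∸-monoˡ-< n<m (ℕₚ.≤-trans j≤i i≤n))) = ℤₚ.*-zeroʳ (u i j)
    ... | inj₂ i<j rewrite u-deg i j i<j = refl

  DegreeBounded-₂ : ∀ {u v} → DegreeBounded u → DegreeBounded v → DegreeBounded (u -₂ v)
  DegreeBounded-₂ u-deg v-deg n m n<m rewrite u-deg n m n<m | v-deg n m n<m = refl

  infix 4 _≈₂_

  _≈₂_ : FPS₂ → FPS₂ → Set
  u ≈₂ v = ∀ n m → u n m ≡ v n m

  mulX : (ℕ → ℤ) → ℕ → ℤ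
  mulX f zero    = + 0
  mulX f (suc k) = f k

  X₁-suc : ∀ j → X₁ (suc j) ≡ δ j
  X₁-suc zero    = refl
  X₁-suc (suc j) = refl

  X₂≡X₁δ : ∀ i j → X₂ i j ≡ X₁ i * δ j
  X₂≡X₁δ zero          j = refl
  X₂≡X₁δ (suc zero)    j = refl
  X₂≡X₁δ (suc (suc i)) j = refl

  sumTo-X₁ : ∀ n (f : ℕ → ℤ) → sumTo n (λ i → f i * X₁ (n ∸ i)) ≡ mulX f n
  sumTo-X₁ zero    f = ℤₚ.*-zeroʳ (f 0)
  sumTo-X₁ (suc k) f = begin
    sumTo k (λ i → f i * X₁ (suc k ∸ i)) + f (suc k) * X₁ (k ∸ k)
      ≡⟨ cong₂ _+_ (sumTo-cong k (λ i i≤k → cong (λ z → f i * X₁ z) (ℕₚ.+-∸-assoc 1 i≤k)))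
                   (trans (cong (λ z → f (suc k) * X₁ z) (ℕₚ.n∸n≡0 k)) (ℤₚ.*-zeroʳ (f (suc k)))) ⟩
    sumTo k (λ i → f i * X₁ (suc (k ∸ i))) + + 0
      ≡⟨ ℤₚ.+-identityʳ _ ⟩
    sumTo k (λ i → f i * X₁ (suc (k ∸ i)))
      ≡⟨ sumTo-cong k (λ i _ → cong (f i *_) (X₁-suc (k ∸ i))) ⟩
    sumTo k (λ i → f i * δ (k ∸ i))
      ≡⟨ sumTo-δ k f ⟩
    f k ∎
    where open ≡-Reasoning

  *₂-congʳ : ∀ u {v v′} → v ≈₂ v′ → u *₂ v ≈₂ u *₂ v′
  *₂-congʳ u v≈v′ n m = sumTo-cong n (λ i _ → sumTo-cong m (λ j _ → cong (u i j *_) (v≈v′ (n ∸ i) (m ∸ j))))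

  *₂-congˡ : ∀ {u u′} v → u ≈₂ u′ → u *₂ v ≈₂ u′ *₂ v
  *₂-congˡ v u≈u′ n m = sumTo-cong n (λ i _ → sumTo-cong m (λ j _ → cong (_* v (n ∸ i) (m ∸ j)) (u≈u′ i j)))

  *₂-comm : ∀ u v → u *₂ v ≈₂ v *₂ u
  *₂-comm u v n m = begin
    sumTo n (λ i → sumTo m (λ j → u i j * v (n ∸ i) (m ∸ j)))
      ≡⟨ sumTo-reverse n _ ⟩
    sumTo n (λ i → sumTo m (λ j → u (n ∸ i) j * v (n ∸ (n ∸ i)) (m ∸ j)))
      ≡⟨ sumTo-cong n (λ i _ → sumTo-reverse m _) ⟩
    sumTo n (λ i → sumTo m (λ j → u (n ∸ i) (m ∸ j) * v (n ∸ (n ∸ i)) (m ∸ (m ∸ j))))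
      ≡⟨ sumTo-cong n (λ i i≤n → sumTo-cong m (λ j j≤m →
           trans (cong₂ (λ p q → u (n ∸ i) (m ∸ j) * v p q) (ℕₚ.m∸[m∸n]≡n i≤n) (ℕₚ.m∸[m∸n]≡n j≤m))
                 (ℤₚ.*-comm (u (n ∸ i) (m ∸ j)) (v i j)))) ⟩
    sumTo n (λ i → sumTo m (λ j → v i j * u (n ∸ i) (m ∸ j))) ∎
    where open ≡-Reasoning

  *₂-product : ∀ u (p q : ℕ → ℤ) → u *₂ (λ a b → p a * q b) ≈₂ λ n m → sumTo n (λ i → sumTo m (λ j → u i j * q (m ∸ j)) * p (n ∸ i))
  *₂-product u p q n m = sumTo-cong n (λ i _ → trans (sumTo-cong m (λ j _ → rearrange (u i j) (p (n ∸ i)) (q (m ∸ j))))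
                                                    (sumTo-*ʳ m (p (n ∸ i)) _))
    where
    rearrange : ∀ (x y z : ℤ) → x * (y * z) ≡ (x * z) * y
    rearrange = solve-∀

  *₂-one : ∀ u → u *₂ one₂ ≈₂ u
  *₂-one u n m = trans (*₂-product u δ δ n m)
    (trans (sumTo-cong n (λ i _ → cong (_* δ (n ∸ i)) (sumTo-δ m (u i)))) (sumTo-δ n (λ i → u i m)))

  *₂-XQ : ∀ u → u *₂ XQ₂ ≈₂ λ n m → mulX (λ i → mulX (u i) m) n
  *₂-XQ u n m = trans (*₂-product u X₁ X₁ n m)
    (trans (sumTo-cong n (λ i _ → cong (_* X₁ (n ∸ i)) (sumTo-X₁ m (u i)))) (sumTo-X₁ n (λ i → mulX (u i) m)))

  Q₂ : FPS₂
  Q₂ a b = δ a * X₁ b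

  *₂-Q : ∀ u → u *₂ Q₂ ≈₂ λ n m → mulX (u n) m
  *₂-Q u n m = trans (*₂-product u δ X₁ n m)
    (trans (sumTo-cong n (λ i _ → cong (_* δ (n ∸ i)) (sumTo-X₁ m (u i)))) (sumTo-δ n (λ i → mulX (u i) m)))

  X₂-*₂ : ∀ v → X₂ *₂ v ≈₂ λ a b → mulX (λ i → v i b) a
  X₂-*₂ v a b = trans (*₂-comm X₂ v a b) (trans (*₂-congʳ v X₂≡X₁δ a b)
    (trans (*₂-product v X₁ δ a b) (trans (sumTo-cong a (λ i _ → cong (_* X₁ (a ∸ i)) (sumTo-δ b (v i)))) (sumTo-X₁ a (λ i → v i b)))))

  *₂-X₂*₂-suc : ∀ u v n m → (u *₂ (X₂ *₂ v)) (suc n) m ≡ (u *₂ v) n m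
  *₂-X₂*₂-suc u v n m = trans (*₂-congʳ u (X₂-*₂ v) (suc n) m)
    (trans (cong₂ _+_ (sumTo-cong n (λ i i≤n → sumTo-cong m (λ j _ → cong (λ z → u i j * mulX (λ i → v i (m ∸ j)) z) (ℕₚ.+-∸-assoc 1 i≤n))))
                      (sumTo-zero m (λ j _ → trans (cong (λ z → u (suc n) j * mulX (λ i → v i (m ∸ j)) z) (ℕₚ.n∸n≡0 (suc n))) (ℤₚ.*-zeroʳ (u (suc n) j)))))
           (ℤₚ.+-identityʳ _))

  *₂-X₂*₂-zero : ∀ u v m → (u *₂ (X₂ *₂ v)) 0 m ≡ + 0
  *₂-X₂*₂-zero u v m = trans (*₂-congʳ u (X₂-*₂ v) 0 m) (sumTo-zero m (λ j _ → ℤₚ.*-zeroʳ (u 0 j)))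

  private
    *-distribˡ-sub : ∀ (x y z : ℤ) → x * (y - z) ≡ x * y - x * z
    *-distribˡ-sub = solve-∀

  *₂-distribˡ-₂ : ∀ u v w → u *₂ (v -₂ w) ≈₂ λ n m → (u *₂ v) n m - (u *₂ w) n m
  *₂-distribˡ-₂ u v w n m = trans (sumTo-cong n (λ i _ → trans (sumTo-cong m (λ j _ → *-distribˡ-sub (u i j) _ _)) (sumTo-sub m _ _))) (sumTo-sub n _ _)

  *₂-distribʳ-+₂ : ∀ u v w → (v +₂ w) *₂ u ≈₂ λ n m → (v *₂ u) n m + (w *₂ u) n m
  *₂-distribʳ-+₂ u v w n m = trans (sumTo-cong n (λ i _ → trans (sumTo-cong m (λ j _ → ℤₚ.*-distribʳ-+ (u (n ∸ i) (m ∸ j)) (v i j) (w i j))) (sumTo-+ m _ _))) (sumTo-+ n _ _)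

  DegreeBounded-one₂ : DegreeBounded one₂
  DegreeBounded-one₂ n (suc m) _ = ℤₚ.*-zeroʳ (δ n)

  X₂-q-free : ∀ n m → X₂ n (suc m) ≡ + 0
  X₂-q-free zero          m = refl
  X₂-q-free (suc zero)    m = refl
  X₂-q-free (suc (suc n)) m = refl

  DegreeBounded-X₂ : DegreeBounded X₂
  DegreeBounded-X₂ n (suc m) _ = X₂-q-free n m

  DegreeBounded-XQ₂ : DegreeBounded XQ₂
  DegreeBounded-XQ₂ zero    (suc m)       _ = refl
  DegreeBounded-XQ₂ (suc n) (suc zero)    (s≤s ())
  DegreeBounded-XQ₂ (suc n) (suc (suc m)) _ = ℤₚ.*-zeroʳ (X₂ (suc n) 0)

  atQ1-cong : ∀ {u v} → u ≈₂ v → atQ1 u ≗ atQ1 v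
  atQ1-cong u≈v n = sumTo-cong n (λ m _ → u≈v n m)

  dQatQ1-cong : ∀ {u v} → u ≈₂ v → dQatQ1 u ≗ dQatQ1 v
  dQatQ1-cong u≈v n = sumTo-cong n (λ m _ → cong (+ m *_) (u≈v n m))

  atQ1-one₂ : atQ1 one₂ ≗ one₁
  atQ1-one₂ zero    = refl
  atQ1-one₂ (suc n) = sumTo-zero (suc n) (λ _ _ → refl)

  dQatQ1-one₂ : ∀ n → dQatQ1 one₂ n ≡ + 0
  dQatQ1-one₂ zero    = refl
  dQatQ1-one₂ (suc n) = sumTo-zero (suc n) (λ m _ → ℤₚ.*-zeroʳ (+ m))

  atQ1-X₂ : atQ1 X₂ ≗ X₁
  atQ1-X₂ zero    = refl
  atQ1-X₂ (suc n) = trans (sumTo-suc n (X₂ (suc n)))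
    (trans (cong (ℤ._+_ (X₂ (suc n) 0)) (sumTo-zero n (λ i _ → X₂-q-free (suc n) i))) (ℤₚ.+-identityʳ _))

  dQatQ1-X₂ : ∀ n → dQatQ1 X₂ n ≡ + 0
  dQatQ1-X₂ n = sumTo-zero n λ { zero _ → refl ; (suc m) _ → trans (cong (+ suc m *_) (X₂-q-free n m)) (ℤₚ.*-zeroʳ (+ suc m)) }

  dQatQ1-XQ₂ : dQatQ1 XQ₂ ≗ X₁
  dQatQ1-XQ₂ zero          = refl
  dQatQ1-XQ₂ (suc zero)    = refl
  dQatQ1-XQ₂ (suc (suc n)) = sumTo-zero (suc (suc n)) (λ m _ → ℤₚ.*-zeroʳ (+ m))

  dQatQ1-sub : ∀ u v → dQatQ1 (u -₂ v) ≗ λ n → dQatQ1 u n - dQatQ1 v n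
  dQatQ1-sub u v n = trans (sumTo-cong n (λ m _ → *-distribˡ-sub (+ m) (u n m) (v n m))) (sumTo-sub n _ _)

  *₁-cong : ∀ {f f′ g g′} → f ≗ f′ → g ≗ g′ → f *₁ g ≗ f′ *₁ g′
  *₁-cong f≗f′ g≗g′ n = sumTo-cong n (λ i _ → cong₂ _*_ (f≗f′ i) (g≗g′ (n ∸ i)))

  *₁-congˡ : ∀ {f f′} g → f ≗ f′ → f *₁ g ≗ f′ *₁ g
  *₁-congˡ {f} {f′} g f≗f′ = *₁-cong {f} {f′} {g} {g} f≗f′ (λ _ → refl)

  *₁-congʳ : ∀ f {g g′} → g ≗ g′ → f *₁ g ≗ f *₁ g′
  *₁-congʳ f {g} {g′} g≗g′ = *₁-cong {f} {f} {g} {g′} (λ _ → refl) g≗g′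

  *₁-comm : ∀ f g → f *₁ g ≗ g *₁ f
  *₁-comm f g n = trans (sumTo-reverse n _)
    (sumTo-cong n (λ i i≤n → trans (cong (λ z → f (n ∸ i) * g z) (ℕₚ.m∸[m∸n]≡n i≤n)) (ℤₚ.*-comm (f (n ∸ i)) (g i))))

  *₁-identityʳ : ∀ f → f *₁ one₁ ≗ f
  *₁-identityʳ f n = sumTo-δ n f

  *₁-assoc : ∀ f g h → (f *₁ g) *₁ h ≗ f *₁ (g *₁ h)
  *₁-assoc f g h n = begin
    sumTo n (λ k → sumTo k (λ i → f i * g (k ∸ i)) * h (n ∸ k))
      ≡⟨ sumTo-cong n (λ k _ → sym (sumTo-*ʳ k _ _)) ⟩
    sumTo n (λ k → sumTo k (λ i → f i * g (k ∸ i) * h (n ∸ k)))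
      ≡⟨ sumTo-triangle n (λ i k → f i * g (k ∸ i) * h (n ∸ k)) ⟩
    sumTo n (λ i → sumTo (n ∸ i) (λ l → f i * g ((i ℕ.+ l) ∸ i) * h (n ∸ (i ℕ.+ l))))
      ≡⟨ sumTo-cong n (λ i _ → trans (sumTo-cong (n ∸ i) (λ l _ →
           trans (cong₂ (λ p q → f i * g p * h q) (ℕₚ.m+n∸m≡n i l) (sym (ℕₚ.∸-+-assoc n i l))) (ℤₚ.*-assoc (f i) _ _)))
           (sumTo-*ˡ (n ∸ i) (f i) _)) ⟩
    sumTo n (λ i → f i * sumTo (n ∸ i) (λ l → g l * h (n ∸ i ∸ l))) ∎
    where open ≡-Reasoning

  *₁-distribˡ-+₁ : ∀ f g h → f *₁ (g +₁ h) ≗ (f *₁ g) +₁ (f *₁ h)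
  *₁-distribˡ-+₁ f g h n = trans (sumTo-cong n (λ i _ → ℤₚ.*-distribˡ-+ (f i) _ _)) (sumTo-+ n _ _)

  *₁-neg : ∀ f g → f *₁ (λ n → - g n) ≗ λ n → - (f *₁ g) n
  *₁-neg f g n = trans (sumTo-cong n (λ i _ → sym (ℤₚ.neg-distribʳ-* (f i) _))) (sumTo-neg n _)

open Series

module GeneratingFunctions where

  open import Data.Integer using (+_; _+_; _*_; _-_; -_)
  open import Algebra.Properties.AbelianGroup ℤₚ.+-0-abelianGroup using (inverseˡ-unique)

  +-sum-upTo : ∀ n (f : ℕ → ℕ) → + sum (map f (upTo (suc n))) ≡ sumTo n (λ i → + f i)
  +-sum-upTo zero    f = cong +_ (ℕₚ.+-identityʳ (f 0))
  +-sum-upTo (suc n) f = begin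
    + sum (map f (upTo (suc (suc n))))              ≡⟨ cong (λ xs → + sum (map f xs)) (Listₚ.upTo-∷ʳ (suc n)) ⟨
    + sum (map f (upTo (suc n) ++ [ suc n ]))       ≡⟨ cong (λ xs → + sum xs) (Listₚ.map-++ f (upTo (suc n)) _) ⟩
    + sum (map f (upTo (suc n)) ++ [ f (suc n) ])   ≡⟨ cong +_ (trans (sum-++ (map f (upTo (suc n))) _) (cong (sum (map f (upTo (suc n))) ℕ.+_) (ℕₚ.+-identityʳ _))) ⟩
    + (sum (map f (upTo (suc n))) ℕ.+ f (suc n))    ≡⟨ ℤₚ.pos-+ _ (f (suc n)) ⟩
    + sum (map f (upTo (suc n))) + + f (suc n)      ≡⟨ cong (_+ + f (suc n)) (+-sum-upTo n f) ⟩
    sumTo (suc n) (λ i → + f i)                     ∎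
    where open ≡-Reasoning

  -- F_τ for a pattern τ that is already reduced, so that F w = Fʳ (red w).
  Fʳ : List ℕ → FPS₂
  Fʳ τ n m = + coef τ n m

  Fʳ-degreeBounded : ∀ τ → DegreeBounded (Fʳ τ)
  Fʳ-degreeBounded τ n m n<m = cong +_ (trans (coef≡count τ n m) (count-none _ (All.tabulate lis≢m)))
    where
    lis≢m : ∀ {σ} → σ ∈ Av τ n → (lis σ ≡ᵇ m) ≡ false
    lis≢m {σ} σ∈ = ¬T⇒≡false λ t → ℕₚ.<-irrefl refl
      (ℕₚ.≤-<-trans (subst (_≤ n) (ℕₚ.≡ᵇ⇒≡ (lis σ) m t)
                       (subst (lis σ ≤_) (length-↭-oneTo (proj₁ (∈-Av⁻ {τ} {n} σ∈))) (lis≤length σ))) n<m)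

  Fʳ-zero : ∀ {τ} → τ ≢ [] → ∀ m → Fʳ τ 0 m ≡ δ m
  Fʳ-zero {τ} τ≢[] m rewrite coef≡count τ 0 m | Av-0 τ≢[] with m
  ... | zero  = refl
  ... | suc _ = refl

  weights : List ℕ → FPS₂
  weights q a j = + lisWeight q a j

  weights≈ : ∀ {q} → q ≢ [] → weights q ≈₂ (Fʳ q -₂ one₂) +₂ Q₂
  weights≈ {q} q≢[] (suc a) j = trans (cong +_ (lisWeight-suc q a j)) (sym (trans (ℤₚ.+-identityʳ _) (ℤₚ.+-identityʳ _)))
  weights≈ {q} q≢[] zero    j rewrite coef≡count q 0 j | Av-0 q≢[] with j
  ... | zero          = refl
  ... | suc zero      = refl
  ... | suc (suc j′)  = refl

  Fʳ-⊖1-suc : ∀ q n m → Fʳ (q ⊖1) (suc n) m ≡ (weights q *₂ Fʳ (q ⊖1)) n m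
  Fʳ-⊖1-suc q n m = begin
    + coef (q ⊖1) (suc n) m
      ≡⟨ cong +_ (coef-⊖1-suc q n m) ⟩
    + sum (map (λ a → sum (map (λ j → lisWeight q a j ℕ.* coef (q ⊖1) (n ∸ a) (m ∸ j)) (upTo (suc m)))) (upTo (suc n)))
      ≡⟨ +-sum-upTo n _ ⟩
    sumTo n (λ a → + sum (map (λ j → lisWeight q a j ℕ.* coef (q ⊖1) (n ∸ a) (m ∸ j)) (upTo (suc m))))
      ≡⟨ sumTo-cong n (λ a _ → trans (+-sum-upTo m _) (sumTo-cong m (λ j _ → ℤₚ.pos-* (lisWeight q a j) _))) ⟩
    (weights q *₂ Fʳ (q ⊖1)) n m ∎
    where open ≡-Reasoning

  module _ (q : List ℕ) (q≢[] : q ≢ []) where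

    private
      Fτ = Fʳ (q ⊖1)
      L  = Fʳ q -₂ one₂
      H  = one₂ -₂ XQ₂ -₂ X₂ *₂ L

    Fʳ-⊖1-recurrence : ∀ n m → Fτ (suc n) m ≡ (Fτ *₂ L) n m + mulX (Fτ n) m
    Fʳ-⊖1-recurrence n m = begin
      Fτ (suc n) m                        ≡⟨ Fʳ-⊖1-suc q n m ⟩
      (weights q *₂ Fτ) n m ≡⟨ *₂-congˡ Fτ (weights≈ q≢[]) n m ⟩
      ((L +₂ Q₂) *₂ Fτ) n m               ≡⟨ *₂-distribʳ-+₂ Fτ L Q₂ n m ⟩
      (L *₂ Fτ) n m + (Q₂ *₂ Fτ) n m      ≡⟨ cong₂ _+_ (*₂-comm L Fτ n m) (trans (*₂-comm Q₂ Fτ n m) (*₂-Q Fτ n m)) ⟩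
      (Fτ *₂ L) n m + mulX (Fτ n) m      ∎
      where open ≡-Reasoning

    Fʳ-⊖1-inverse : Fτ *₂ H ≈₂ one₂
    Fʳ-⊖1-inverse n m =
      trans (*₂-distribˡ-₂ Fτ (one₂ -₂ XQ₂) (X₂ *₂ L) n m)
            (trans (cong (_- (Fτ *₂ (X₂ *₂ L)) n m) (trans (*₂-distribˡ-₂ Fτ one₂ XQ₂ n m) (cong₂ _-_ (*₂-one Fτ n m) (*₂-XQ Fτ n m))))
                   (coefficient n))
      where
      cancel : ∀ (a s : ℤ) → ((a + s) - s) - a ≡ + 0
      cancel = solve-∀
      coefficient : ∀ n → (Fτ n m - mulX (λ i → mulX (Fτ i) m) n) - (Fτ *₂ (X₂ *₂ L)) n m ≡ one₂ n m
      coefficient zero    = begin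
        (Fτ 0 m + + 0) - (Fτ *₂ (X₂ *₂ L)) 0 m ≡⟨ cong₂ (λ a b → (a + + 0) - b) (Fʳ-zero (⊖1≢[] q) m) (*₂-X₂*₂-zero Fτ L m) ⟩
        (δ m + + 0) + + 0                       ≡⟨ trans (ℤₚ.+-identityʳ _) (trans (ℤₚ.+-identityʳ _) (sym (ℤₚ.*-identityˡ (δ m)))) ⟩
        one₂ 0 m                                 ∎
        where open ≡-Reasoning
      coefficient (suc n) = begin
        (Fτ (suc n) m - mulX (Fτ n) m) - (Fτ *₂ (X₂ *₂ L)) (suc n) m
          ≡⟨ cong₂ (λ a b → (a - mulX (Fτ n) m) - b) (Fʳ-⊖1-recurrence n m) (*₂-X₂*₂-suc Fτ L n m) ⟩
        (((Fτ *₂ L) n m + mulX (Fτ n) m) - mulX (Fτ n) m) - (Fτ *₂ L) n m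
          ≡⟨ cancel ((Fτ *₂ L) n m) (mulX (Fτ n) m) ⟩
        + 0 ∎
        where open ≡-Reasoning

    private
      A = atQ1 Fτ
      D = dQatQ1 Fτ
      h = atQ1 H
      E = one₁ +₁ dQatQ1 (Fʳ q)
      L-bounded : DegreeBounded L
      L-bounded = DegreeBounded-₂ (Fʳ-degreeBounded q) DegreeBounded-one₂
      H-bounded : DegreeBounded H
      H-bounded = DegreeBounded-₂ (DegreeBounded-₂ DegreeBounded-one₂ DegreeBounded-XQ₂) (DegreeBounded-*₂ DegreeBounded-X₂ L-bounded)

    A*h≗1 : A *₁ h ≗ one₁
    A*h≗1 n = trans (sym (atQ1-*₂ Fτ H (Fʳ-degreeBounded (q ⊖1)) H-bounded n)) (trans (atQ1-cong Fʳ-⊖1-inverse n) (atQ1-one₂ n))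

    D*h+A*dH≡0 : ∀ n → (D *₁ h) n + (A *₁ dQatQ1 H) n ≡ + 0
    D*h+A*dH≡0 n = trans (sym (dQatQ1-*₂ Fτ H (Fʳ-degreeBounded (q ⊖1)) H-bounded n)) (trans (dQatQ1-cong Fʳ-⊖1-inverse n) (dQatQ1-one₂ n))

    dQatQ1-H : dQatQ1 H ≗ λ n → - (X₁ *₁ E) n
    dQatQ1-H n = begin
      dQatQ1 H n
        ≡⟨ dQatQ1-sub (one₂ -₂ XQ₂) (X₂ *₂ L) n ⟩
      dQatQ1 (one₂ -₂ XQ₂) n - dQatQ1 (X₂ *₂ L) n
        ≡⟨ cong₂ _-_ (trans (dQatQ1-sub one₂ XQ₂ n) (cong₂ _-_ (dQatQ1-one₂ n) (dQatQ1-XQ₂ n))) dQatQ1-X₂*₂L ⟩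
      (+ 0 - X₁ n) - (X₁ *₁ dQatQ1 (Fʳ q)) n
        ≡⟨ regroup (X₁ n) _ ⟩
      - (X₁ n + (X₁ *₁ dQatQ1 (Fʳ q)) n)
        ≡⟨ cong -_ (trans (*₁-distribˡ-+₁ X₁ one₁ (dQatQ1 (Fʳ q)) n) (cong (_+ (X₁ *₁ dQatQ1 (Fʳ q)) n) (*₁-identityʳ X₁ n))) ⟨
      - (X₁ *₁ E) n ∎
      where
      open ≡-Reasoning
      regroup : ∀ (x y : ℤ) → (+ 0 - x) - y ≡ - (x + y)
      regroup = solve-∀
      dQatQ1-L : dQatQ1 L ≗ dQatQ1 (Fʳ q)
      dQatQ1-L n = trans (dQatQ1-sub (Fʳ q) one₂ n) (trans (cong (ℤ._-_ (dQatQ1 (Fʳ q) n)) (dQatQ1-one₂ n)) (ℤₚ.+-identityʳ _))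
      dQatQ1-X₂*₂L : dQatQ1 (X₂ *₂ L) n ≡ (X₁ *₁ dQatQ1 (Fʳ q)) n
      dQatQ1-X₂*₂L = trans (dQatQ1-*₂ X₂ L DegreeBounded-X₂ L-bounded n)
        (trans (cong₂ _+_ (sumTo-zero n (λ i _ → cong (_* atQ1 L (n ∸ i)) (dQatQ1-X₂ i))) (*₁-cong atQ1-X₂ dQatQ1-L n))
               (ℤₚ.+-identityˡ _))

    D*h≗A*X*E : D *₁ h ≗ A *₁ (X₁ *₁ E)
    D*h≗A*X*E n = begin
      (D *₁ h) n                      ≡⟨ inverseˡ-unique _ _ (D*h+A*dH≡0 n) ⟩
      - (A *₁ dQatQ1 H) n             ≡⟨ cong -_ (trans (*₁-congʳ A dQatQ1-H n) (*₁-neg A (X₁ *₁ E) n)) ⟩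
      - - (A *₁ (X₁ *₁ E)) n          ≡⟨ ℤₚ.neg-involutive _ ⟩
      (A *₁ (X₁ *₁ E)) n              ∎
      where open ≡-Reasoning

    Fʳ-⊖1-derivative : D ≗ (X₁ *₁ (A *₁ A)) *₁ E
    Fʳ-⊖1-derivative = begin
      D                            ≈⟨ *₁-identityʳ D ⟨
      D *₁ one₁                    ≈⟨ *₁-congʳ D A*h≗1 ⟨
      D *₁ (A *₁ h)                ≈⟨ *₁-congʳ D (*₁-comm A h) ⟩
      D *₁ (h *₁ A)                ≈⟨ *₁-assoc D h A ⟨
      (D *₁ h) *₁ A                ≈⟨ *₁-congˡ A D*h≗A*X*E ⟩
      (A *₁ (X₁ *₁ E)) *₁ A        ≈⟨ *₁-comm (A *₁ (X₁ *₁ E)) A ⟩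
      A *₁ (A *₁ (X₁ *₁ E))        ≈⟨ *₁-assoc A A (X₁ *₁ E) ⟨
      (A *₁ A) *₁ (X₁ *₁ E)        ≈⟨ *₁-assoc (A *₁ A) X₁ E ⟨
      ((A *₁ A) *₁ X₁) *₁ E        ≈⟨ *₁-congˡ E (*₁-comm (A *₁ A) X₁) ⟩
      (X₁ *₁ (A *₁ A)) *₁ E        ∎
      where open import Relation.Binary.Reasoning.Setoid (ℕ →-setoid ℤ)

open GeneratingFunctions

F-ρ1 : ∀ {k ρ} → ρ ++ 1 ∷ [] ∈ S k → F (ρ ++ 1 ∷ []) ≡ Fʳ (red ρ ⊖1)
F-ρ1 {k} {ρ} τ∈S = cong Fʳ (red-∷ʳ-min ρ (All.tabulate above-1))
  where
  τ↭ = S-sound k τ∈S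
  above-1 : ∀ {x} → x ∈ ρ → 1 < x
  above-1 x∈ = ℕₚ.≤∧≢⇒< (proj₁ (All.lookup (∈-↭-oneTo τ↭) (∈-++⁺ˡ x∈)))
                        (Unique-++-disjoint ρ (Unique-↭-oneTo τ↭) x∈ (here refl) ∘ sym)

red-nonempty : ∀ {k} ρ → 2 ≤ k → ρ ++ 1 ∷ [] ∈ S k → red ρ ≢ []
red-nonempty {k} []      2≤k τ∈S _ with length-↭-oneTo (S-sound k τ∈S)
... | refl with 2≤k
...   | s≤s ()
red-nonempty     (x ∷ ρ) _   _   ()

corollary2p6 : (k : ℕ) → (ρ : List ℕ) → 2 ≤ k → (ρ ++ 1 ∷ []) ∈ S k → T (avoids (ρ ++ 1 ∷ []) p312) →
    ((n m : ℕ) → (F (ρ ++ 1 ∷ []) *₂ (one₂ -₂ XQ₂ -₂ X₂ *₂ (F ρ -₂ one₂))) n m ≡ one₂ n m)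
    × ((n : ℕ) → dQatQ1 (F (ρ ++ 1 ∷ [])) n ≡ (X₁ *₁ (atQ1 (F (ρ ++ 1 ∷ [])) *₁ atQ1 (F (ρ ++ 1 ∷ []))) *₁ (one₁ +₁ dQatQ1 (F ρ))) n)
corollary2p6 k ρ 2≤k τ∈S _ =
  subst (λ Fτ → ((n m : ℕ) → (Fτ *₂ (one₂ -₂ XQ₂ -₂ X₂ *₂ (F ρ -₂ one₂))) n m ≡ one₂ n m)
              × ((n : ℕ) → dQatQ1 Fτ n ≡ (X₁ *₁ (atQ1 Fτ *₁ atQ1 Fτ) *₁ (one₁ +₁ dQatQ1 (F ρ))) n))
        (sym (F-ρ1 {k} τ∈S))
        (Fʳ-⊖1-inverse (red ρ) red-ρ≢[] , Fʳ-⊖1-derivative (red ρ) red-ρ≢[])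
  where red-ρ≢[] = red-nonempty ρ 2≤k τ∈S
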